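{- Fix positive integers $k,d,h$ and a (deterministic) label subset $L'\subseteq L$ with $|L'|=c$; put $a=c/k$ and assume $d>8a$. Then, over the random choice of the permutations, the probability that $F$ is a good configuration, i.e., that $s$ and $t$ are disconnected in the graph $\mathcal{H}_{\Phi'}$ after removing all edges whose labels lie in $L'$, is at most \[ \left[1-\left(1-\frac{8a}{d}\right)^{4a}\right]^{\frac12 h (3k/4)(3k/4-1)}. \]
   Context: Random instance $\mathcal{I}(k,d,h)$: $\Phi=\{1,\dots,k\}$, $[d]=\{1,\dots,d\}$, $L=\{(\mu,j):\mu\in\Phi,j\in[d]\}$. A chain for elements $\mu,\nu$ and permutation $\sigma$ of $[d]$ has vertices $x_0,\dots,x_d$ and for each $j\in[d]$ a 4-cycle on $x_{j-1},u_j,x_j,w_j$ whose top edges $x_{j-1}u_j,u_jx_j$ are labeled $(\mu,j)$ and bottom edges $x_{j-1}w_j,w_jx_j$ labeled $(\nu,\sigma(j))$; endpoints $x_0,x_d$. For $\mu<\nu$ in $\Phi$ the shutter $H_{\mu\nu}$ consists of $h$ chains $C^1_{\mu\nu},\dots,C^h_{\mu\nu}$ for $\mu,\nu$ (permutations $\sigma^i_{\mu\nu}$) with all left endpoints identified and all right endpoints identified. The full graph is the union of all shutters with left endpoints identified to $s$ and right endpoints to $t$. All permutations are independent uniformly random permutations of $[d]$. For $L'\subseteq L$: $J_\mu=\{j\in[d]:(\mu,j)\in L'\}$, $a=|L'|/k$, light ground set $\Phi'=\{\mu\in\Phi:|J_\mu|\le 4a\}$, configuration $F=\{(\mu,j)\in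 L':\mu\in\Phi'\}$. $\mathcal{H}_{\Phi'}$ is the subgraph formed by the shutters $H_{\mu\nu}$ with $\mu,\nu\in\Phi'$, $\mu<\nu$ (sharing the vertices $s$ and $t$). $F$ is called good if removing the edges with labels in $F$ (equivalently, in $L'$) disconnects $s$ and $t$ in $\mathcal{H}_{\Phi'}$. -}

module Defs where

open import Data.Nat as ℕ using (ℕ; zero; suc; _+_; _*_; _∸_; _≤ᵇ_; _≡ᵇ_)
open import Data.Bool using (Bool; if_then_else_)
open import Data.Fin using (Fin; toℕ) renaming (_<_ to _<ᶠ_)
open import Data.Fin.Subset using (Subset; _∈_; ∣_∣)
open import Data.Vec using (Vec; lookup)
open import Data.Product using (_×_; _,_; ∃-syntax; proj₁; proj₂)
open import Data.Sum using (_⊎_)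
open import Data.Integer using (+_)
open import Data.Rational using (ℚ; 0ℚ; 1ℚ; _/_; _-_; _≤_; _<_) renaming (_*_ to _*ℚ_)
open import Relation.Nullary using (¬_)
open import Relation.Binary.PropositionalEquality using (_≡_)
open import Relation.Binary.Construct.Closure.ReflexiveTransitive using (Star)

_^ℚ_ : ℚ → ℕ → ℚ
q ^ℚ zero  = 1ℚ
q ^ℚ suc n = q *ℚ (q ^ℚ n)

-- m / n as a rational (junk value 0 when n = 0; never used with n = 0)
frac : ℕ → ℕ → ℚ
frac m zero    = 0ℚ
frac m (suc n) = + m / suc n

sumFin : (n : ℕ) → (Fin n → ℕ) → ℕ
sumFin zero    f = 0
sumFin (suc n) f = f Fin.zero + sumFin n (λ i → f (Fin.suc i))

-- Labels.  Φ = Fin k, [d] = Fin d (j : Fin d stands for j+1).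
-- A label subset L' ⊆ L = Φ × [d] is given by J : Fin k → Subset d,
-- J μ = J_μ = { j | (μ , j) ∈ L' }.

card : {k d : ℕ} → (Fin k → Subset d) → ℕ
card {k} J = sumFin k (λ μ → ∣ J μ ∣)

-- μ ∈ Φ'  iff  |J_μ| ≤ 4a = 4c/k  iff  k·|J_μ| ≤ 4c
Light : {k d : ℕ} → (Fin k → Subset d) → Fin k → Set
Light {k} J μ = k * ∣ J μ ∣ ℕ.≤ 4 * card J

-- Random data: one permutation σ^i_{μν} of [d] for each μ, ν ∈ Φ, i ∈ Fin h
-- (the ones with μ ≥ ν are dummies not used by the graph; they do not
-- affect the probability).  A permutation is stored as the vector of its values.

Outcome : ℕ → ℕ → ℕ → Set
Outcome k d h = Vec (Vec (Vec (Vec (Fin d) d) h) k) k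

perm : {k d h : ℕ} → Outcome k d h → Fin k → Fin k → Fin h → Fin d → Fin d
perm ω μ ν i j = lookup (lookup (lookup (lookup ω μ) ν) i) j

-- a vector of values is a permutation of [d] iff it is injective
IsPerm : {d : ℕ} → Vec (Fin d) d → Set
IsPerm {d} v = (j j' : Fin d) → lookup v j ≡ lookup v j' → j ≡ j'

Valid : {k d h : ℕ} → Outcome k d h → Set
Valid {k} {d} {h} ω = (μ ν : Fin k) (i : Fin h) →
  IsPerm (lookup (lookup (lookup ω μ) ν) i)

-- The graph.  Vertices: s, t, inner chain vertices x_n (1 ≤ n ≤ d-1) of
-- chain C^i_{μν}, and u_j, w_j of that chain.

data Vtx (k d h : ℕ) : Set where
  s t : Vtx k d h
  X   : Fin k → Fin k → Fin h → ℕ → Vtx k d h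
  U W : Fin k → Fin k → Fin h → Fin d → Vtx k d h

xv : {k d h : ℕ} → Fin k → Fin k → Fin h → ℕ → Vtx k d h
xv {d = d} μ ν i n =
  if n ≡ᵇ 0 then s else (if n ≡ᵇ d then t else X μ ν i n)

-- For j : Fin d (standing for j+1): top edges x_j u_{j+1}, u_{j+1} x_{j+1}
-- labelled (μ , j+1), bottom edges x_j w_{j+1}, w_{j+1} x_{j+1}
-- labelled (ν , σ(j+1)).
data Edge {k d h : ℕ} (ω : Outcome k d h) :
     Fin k → Fin k → Vtx k d h → Vtx k d h → Fin k × Fin d → Set where
  top-l : ∀ {μ ν} (i : Fin h) (j : Fin d) → μ <ᶠ ν →
    Edge ω μ ν (xv μ ν i (toℕ j)) (U μ ν i j) (μ , j)
  top-r : ∀ {μ ν} (i : Fin h) (j : Fin d) → μ <ᶠ ν →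
    Edge ω μ ν (U μ ν i j) (xv μ ν i (suc (toℕ j))) (μ , j)
  bot-l : ∀ {μ ν} (i : Fin h) (j : Fin d) → μ <ᶠ ν →
    Edge ω μ ν (xv μ ν i (toℕ j)) (W μ ν i j) (ν , perm ω μ ν i j)
  bot-r : ∀ {μ ν} (i : Fin h) (j : Fin d) → μ <ᶠ ν →
    Edge ω μ ν (W μ ν i j) (xv μ ν i (suc (toℕ j))) (ν , perm ω μ ν i j)

Adj : {k d h : ℕ} → (Fin k → Subset d) → Outcome k d h →
      Vtx k d h → Vtx k d h → Set
Adj J ω u v = ∃[ μ ] ∃[ ν ] ∃[ ℓ ]
  (Light J μ × Light J ν × Edge ω μ ν u v ℓ × ¬ (proj₂ ℓ ∈ J (proj₁ ℓ)))

SAdj : {k d h : ℕ} → (Fin k → Subset d) → Outcome k d h →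
       Vtx k d h → Vtx k d h → Set
SAdj J ω u v = Adj J ω u v ⊎ Adj J ω v u

Good : {k d h : ℕ} → (Fin k → Subset d) → Outcome k d h → Set
Good J ω = ¬ Star (SAdj J ω) s t

-- The real bound  B = [1 - Z^{4a}]^N,  Z = 1 - 8a/d = 1 - 8c/(dk),
-- a = c/k,  N = h (3k/4)(3k/4 - 1)/2 = 3hk(3k-4)/32,  Y = 1 - Z^{4c/k}.
-- No reals in the library: "p ≤ B" is expressed through rational
-- comparisons only.

Zq : ℕ → ℕ → ℕ → ℚ
Zq c zero    k       = 0ℚ
Zq c (suc d) zero    = 0ℚ
Zq c (suc d) (suc k) = 1ℚ - (+ (8 * c)) / (suc d * suc k)

-- y ≥ Y  (i.e. 1 - y ≤ Z^{4c/k})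
AboveY : ℕ → ℕ → ℕ → ℚ → Set
AboveY k d c y = (1ℚ - y ≤ 0ℚ) ⊎ (((1ℚ - y) ^ℚ k) ≤ (Zq c d k ^ℚ (4 * c)))

-- y ≤ Y  (i.e. Z^{4c/k} ≤ 1 - y)
BelowY : ℕ → ℕ → ℕ → ℚ → Set
BelowY k d c y = (0ℚ ≤ 1ℚ - y) × ((Zq c d k ^ℚ (4 * c)) ≤ ((1ℚ - y) ^ℚ k))

-- p ≤ Y^N with N = P/32.
--  * if 3k ≥ 4 (N > 0):  p^32 ≤ y^P for every rational y ≥ Y;
--  * if 3k < 4 (N < 0):  p^32 · y^{|P|} ≤ 1 for every rational 0 < y ≤ Y
--    (with Y^N = +∞ when Y = 0).
BelowBound : (k d h c : ℕ) → ℚ → Set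
BelowBound k d h c p =
  if 4 ≤ᵇ 3 * k
  then ((y : ℚ) → AboveY k d c y →
          (p ^ℚ 32) ≤ (y ^ℚ (3 * h * k * (3 * k ∸ 4))))
  else ((y : ℚ) → 0ℚ < y → BelowY k d c y →
          ((p ^ℚ 32) *ℚ (y ^ℚ (3 * h * k * (4 ∸ 3 * k)))) ≤ 1ℚ)

-- The permutations σ^i_{μν} are independent, so the good outcomes number at most the product,
-- over all chains, of the permutations that may label that chain.  For light μ < ν (by Markov's
-- inequality at least 3k/4 elements are light) a good outcome must cut every chain C^i_{μν}, and
-- it can only do so if σ^i_{μν} sends some j ∈ J_μ into J_ν: otherwise every 4-cycle keeps its top
-- or its bottom path.  Choosing images position by position, at least (s+1)⋯(s+m) (s+n)! of the
-- d! permutations avoid this, where m = |J_μ|, n = |J_ν| ≤ 4a and s = d - m - n ≥ (1 - 8a/d) d.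
-- So a light chain is cut with probability at most 1 - (s/d)^m ≤ 1 - (1 - 8a/d)^{4a}.
module Submission where

module Counting where

  open import Data.Nat using (ℕ; zero; suc; _+_; _*_; _∸_; _≤_; z≤n; s≤s)
  open import Data.Nat.Properties using (≤-trans; ≤-pred; +-mono-≤; +-suc; m+n≤o⇒m≤o∸n; ∸-monoʳ-≤)
  open import Data.Fin using (Fin; zero; suc)
  open import Data.Fin.Properties using (suc-injective) renaming (_≟_ to _≟ᶠ_)
  open import Data.Vec using (Vec; []; _∷_; lookup; uncons)
  open import Data.List using (List; []; _∷_; [_]; _++_; length; map; filter)
  open import Data.List.Properties using (length-map; length-++)
  open import Data.List.Relation.Unary.All as All using (All; []; _∷_)
  import Data.List.Relation.Unary.All.Properties as All
  open import Data.List.Relation.Unary.AllPairs using ([]; _∷_)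
  open import Data.List.Relation.Unary.Unique.Propositional using (Unique)
  import Data.List.Relation.Unary.Unique.Propositional.Properties as Unique
  open import Data.Product using (Σ; _×_; _,_; proj₁; proj₂)
  open import Data.Unit using (⊤; tt)
  open import Data.Empty using (⊥)
  open import Data.List.Membership.Propositional using (_∈_)
  open import Relation.Nullary using (¬_; yes; no; contradiction)
  open import Relation.Unary using (Decidable)
  open import Relation.Unary.Properties using (∁?)
  open import Relation.Binary.Definitions using (DecidableEquality)
  open import Relation.Binary.PropositionalEquality using (_≡_; _≢_; refl; sym; trans; cong; subst)

  open import Defs using (sumFin)

  private variable
    A B : Set
    P Q : A → Set
    M N : ℕ

  AtMost : (A → Set) → ℕ → Set
  AtMost {A} P N = (xs : List A) → Unique xs → All P xs → length xs ≤ N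

  AtLeast : (A → Set) → ℕ → Set
  AtLeast {A} P N = Σ (List A) λ xs → Unique xs × All P xs × N ≤ length xs

  prodFin : (n : ℕ) → (Fin n → ℕ) → ℕ
  prodFin zero    f = 1
  prodFin (suc n) f = f zero * prodFin n (λ i → f (suc i))

  atMost-mono : (∀ {x} → P x → Q x) → AtMost Q N → AtMost P N
  atMost-mono P⇒Q bound xs u ps = bound xs u (All.map P⇒Q ps)

  atMost-∅ : (∀ x → ¬ P x) → AtMost P 0
  atMost-∅ ¬P []       _ _        = z≤n
  atMost-∅ ¬P (x ∷ xs) _ (px ∷ _) = contradiction px (¬P x)

  atMost-≡ : (c : A) → AtMost (_≡ c) 1
  atMost-≡ c []          _               _               = z≤n
  atMost-≡ c (_ ∷ [])    _               _               = s≤s z≤n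
  atMost-≡ c (_ ∷ _ ∷ _) ((x≢y ∷ _) ∷ _) (x≡c ∷ y≡c ∷ _) = contradiction (trans x≡c (sym y≡c)) x≢y

  unique-map-injectiveOn : (f : A → B) → (∀ {x y} → P x → P y → f x ≡ f y → x ≡ y) →
                           ∀ {xs} → Unique xs → All P xs → Unique (map f xs)
  unique-map-injectiveOn f inj [] [] = []
  unique-map-injectiveOn {P = P} f inj (x∉xs ∷ u) (px ∷ ps) =
    images px x∉xs ps ∷ unique-map-injectiveOn f inj u ps
    where
    images : ∀ {x ys} → P x → All (x ≢_) ys → All P ys → All (f x ≢_) (map f ys)
    images px []         []         = []
    images px (x≢y ∷ ne) (py ∷ ps) = (λ e → x≢y (inj px py e)) ∷ images px ne ps

  atMost-injectiveOn : (f : A → B) → (∀ {x y} → P x → P y → f x ≡ f y → x ≡ y) →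
                       (∀ {x} → P x → Q (f x)) → AtMost Q N → AtMost P N
  atMost-injectiveOn f inj P⇒Qf bound xs u ps =
    subst (_≤ _) (length-map f xs)
      (bound (map f xs) (unique-map-injectiveOn f inj u ps) (All.map⁺ (All.map P⇒Qf ps)))

  length-filter+filter-∁ : (P? : Decidable P) (xs : List A) →
                           length (filter P? xs) + length (filter (∁? P?) xs) ≡ length xs
  length-filter+filter-∁ P? [] = refl
  length-filter+filter-∁ P? (x ∷ xs) with P? x
  ... | yes _ = cong suc (length-filter+filter-∁ P? xs)
  ... | no  _ = trans (+-suc _ _) (cong suc (length-filter+filter-∁ P? xs))

  atMost-split : (P? : Decidable P) → AtMost (λ x → Q x × P x) M → AtMost (λ x → Q x × ¬ P x) N →
                 AtMost Q (M + N)
  atMost-split {Q = Q} P? yes-bound no-bound xs u qs =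
    subst (_≤ _) (length-filter+filter-∁ P? xs)
      (+-mono-≤ (part yes-bound P?) (part no-bound (∁? P?)))
    where
    part : ∀ {R} {K} → AtMost (λ x → Q x × R x) K → (R? : Decidable R) → length (filter R? xs) ≤ K
    part bound R? = bound _ (Unique.filter⁺ R? u) (All.zip (All.filter⁺ R? qs , All.all-filter R? xs))

  atMost-Σ : {R : A → B → Set} → DecidableEquality A → ∀ M N → AtMost P M → (∀ x → AtMost (R x) N) →
             AtMost (λ p → P (proj₁ p) × R (proj₁ p) (proj₂ p)) (M * N)
  atMost-Σ _≟_ M N bound-P bound-R [] _ _ = z≤n
  atMost-Σ _≟_ zero N bound-P bound-R ((x , _) ∷ _) _ ((px , _) ∷ _) =
    contradiction (bound-P [ x ] ([] ∷ []) (px ∷ [])) λ ()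
  atMost-Σ {P = P} {R = R} _≟_ (suc M) N bound-P bound-R ps@((x , _) ∷ _) u qs@((px , _) ∷ _) =
    atMost-split (λ p → proj₁ p ≟ x) fibre rest ps u qs
    where
    fibre : AtMost (λ p → (P (proj₁ p) × R (proj₁ p) (proj₂ p)) × proj₁ p ≡ x) N
    fibre = atMost-injectiveOn proj₂ (λ { (_ , refl) (_ , refl) refl → refl }) (λ { ((_ , r) , refl) → r })
              (bound-R x)
    others : AtMost (λ z → P z × z ≢ x) M
    others zs u′ qs′ =
      ≤-pred (bound-P (x ∷ zs) (All.map (λ (_ , z≢x) x≡z → z≢x (sym x≡z)) qs′ ∷ u′) (px ∷ All.map proj₁ qs′))
    rest : AtMost (λ p → (P (proj₁ p) × R (proj₁ p) (proj₂ p)) × proj₁ p ≢ x) (M * N)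
    rest = atMost-mono (λ ((p , r) , ne) → (p , ne) , r) (atMost-Σ _≟_ M N others bound-R)

  atMost-Fin : ∀ n → AtMost (λ (_ : Fin n) → ⊤) n
  atMost-Fin zero    = atMost-∅ λ ()
  atMost-Fin (suc n) = atMost-split (_≟ᶠ zero) (atMost-mono proj₂ (atMost-≡ zero)) (nonzero n)
    where
    shrink : ∀ {m} → Fin (suc (suc m)) → Fin (suc m)
    shrink zero    = zero
    shrink (suc j) = j
    nonzero : ∀ m → AtMost (λ (j : Fin (suc m)) → ⊤ × j ≢ zero) m
    nonzero zero    = atMost-∅ λ { zero (_ , ne) → ne refl }
    nonzero (suc m) = atMost-injectiveOn shrink inj (λ _ → tt) (atMost-Fin (suc m))
      where
      inj : ∀ {i j : Fin (suc (suc m))} → ⊤ × i ≢ zero → ⊤ × j ≢ zero → shrink i ≡ shrink j → i ≡ j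
      inj {zero}          (_ , ne) _        _ = contradiction refl ne
      inj {suc _} {zero}  _        (_ , ne) _ = contradiction refl ne
      inj {suc _} {suc _} _        _        e = cong suc e

  atMost-[] : {P : Vec A 0 → Set} → AtMost P 1
  atMost-[] = atMost-mono (λ { {[]} _ → refl }) (atMost-≡ [])

  atMost-Vec : DecidableEquality A → (n : ℕ) (P : Fin n → A → Set) (N : Fin n → ℕ) →
               (∀ i → AtMost (P i) (N i)) → AtMost (λ v → ∀ i → P i (lookup v i)) (prodFin n N)
  atMost-Vec _≟_ zero P N bounds = atMost-[]
  atMost-Vec _≟_ (suc n) P N bounds =
    atMost-injectiveOn uncons (λ { {_ ∷ _} {_ ∷ _} _ _ refl → refl }) (λ { {_ ∷ _} p → p zero , λ i → p (suc i) })
      (atMost-Σ _≟_ (N zero) (prodFin n (λ i → N (suc i))) (bounds zero)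
        (λ _ → atMost-Vec _≟_ n (λ i → P (suc i)) (λ i → N (suc i)) (λ i → bounds (suc i))))

  atLeast-zero : AtLeast P 0
  atLeast-zero = [] , [] , [] , z≤n

  atLeast-≤ : M ≤ N → AtLeast P N → AtLeast P M
  atLeast-≤ M≤N (xs , u , ps , N≤) = xs , u , ps , ≤-trans M≤N N≤

  atLeast-injectiveOn : (f : A → B) → (∀ {x y} → P x → P y → f x ≡ f y → x ≡ y) →
                        (∀ {x} → P x → Q (f x)) → AtLeast P N → AtLeast Q N
  atLeast-injectiveOn f inj P⇒Qf (xs , u , ps , N≤) =
    map f xs , unique-map-injectiveOn f inj u ps , All.map⁺ (All.map P⇒Qf ps) ,
    subst (_ ≤_) (sym (length-map f xs)) N≤

  atLeast⇒≤ : AtMost P N → AtLeast P M → M ≤ N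
  atLeast⇒≤ bound (xs , u , ps , M≤) = ≤-trans M≤ (bound xs u ps)

  atMost-∸ : {R : A → Set} → AtMost P N → AtLeast (λ x → P x × R x) M → AtMost (λ x → P x × ¬ R x) (N ∸ M)
  atMost-∸ {N = N} bound (ys , u-ys , rs , M≤) xs u-xs qs =
    ≤-trans (m+n≤o⇒m≤o∸n (length xs) total) (∸-monoʳ-≤ N M≤)
    where
    disjoint : ∀ {v} → ¬ (v ∈ xs × v ∈ ys)
    disjoint (v∈xs , v∈ys) = proj₂ (All.lookup qs v∈xs) (proj₂ (All.lookup rs v∈ys))
    total : length xs + length ys ≤ N
    total = subst (_≤ _) (length-++ xs)
      (bound (xs ++ ys) (Unique.++⁺ u-xs u-ys disjoint) (All.++⁺ (All.map proj₁ qs) (All.map proj₁ rs)))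

  atLeast-mono : (∀ {x} → P x → Q x) → AtLeast P N → AtLeast Q N
  atLeast-mono P⇒Q = atLeast-injectiveOn (λ x → x) (λ _ _ e → e) P⇒Q

  atLeast-++ : {R : A → Set} → (∀ {x} → Q x → R x → ⊥) →
               AtLeast (λ x → P x × Q x) M → AtLeast (λ x → P x × R x) N → AtLeast P (M + N)
  atLeast-++ disjoint (xs , u-xs , qs , M≤) (ys , u-ys , rs , N≤) =
    xs ++ ys ,
    Unique.++⁺ u-xs u-ys (λ (v∈xs , v∈ys) → disjoint (proj₂ (All.lookup qs v∈xs)) (proj₂ (All.lookup rs v∈ys))) ,
    All.++⁺ (All.map proj₁ qs) (All.map proj₁ rs) ,
    subst (_ ≤_) (sym (length-++ xs)) (+-mono-≤ M≤ N≤)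

  atLeast-sumFin : {K : Set} (tag : A → K) (n : ℕ) (key : Fin n → K) → (∀ {i j} → key i ≡ key j → i ≡ j) →
                   (N : Fin n → ℕ) → (∀ i → AtLeast (λ x → P x × tag x ≡ key i) (N i)) →
                   AtLeast (λ x → P x × Σ (Fin n) λ i → tag x ≡ key i) (sumFin n N)
  atLeast-sumFin tag zero    key key-inj N lists = atLeast-zero
  atLeast-sumFin tag (suc n) key key-inj N lists =
    atLeast-++ disjoint
      (atLeast-mono (λ (p , e) → (p , zero , e) , e) (lists zero))
      (atLeast-mono (λ (p , i , e) → (p , suc i , e) , i , e)
        (atLeast-sumFin tag n (λ i → key (suc i)) (λ e → suc-injective (key-inj e)) (λ i → N (suc i)) (λ i → lists (suc i))))
    where
    disjoint : ∀ {x} → tag x ≡ key zero → Σ (Fin n) (λ i → tag x ≡ key (suc i)) → ⊥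
    disjoint e (i , e′) with key-inj (trans (sym e) e′)
    ... | ()

  atLeast-byTag : {n : ℕ} (tag : A → Fin n) (N : Fin n → ℕ) → (∀ i → AtLeast (λ x → P x × tag x ≡ i) (N i)) →
                  AtLeast P (sumFin n N)
  atLeast-byTag {n = n} tag N lists = atLeast-mono proj₁ (atLeast-sumFin tag n (λ i → i) (λ e → e) N lists)

module Sums where

  open import Data.Bool using (Bool; true; false; not; if_then_else_)
  open import Data.Nat using (ℕ; zero; suc; _+_; _*_; _≤_; z≤n)
  open import Data.Nat.Properties
  open import Algebra.Properties.CommutativeSemigroup +-commutativeSemigroup using (x∙yz≈y∙xz)
  open import Data.Fin using (Fin; zero; suc; punchIn)
  open import Relation.Binary.PropositionalEquality using (_≡_; refl; sym; trans; cong; cong₂; subst)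

  open import Defs using (sumFin)

  indicator : Bool → ℕ
  indicator true  = 1
  indicator false = 0

  count : (n : ℕ) → (Fin n → Bool) → ℕ
  count n f = sumFin n (λ i → indicator (f i))

  sumFin-cong : ∀ n {f g : Fin n → ℕ} → (∀ i → f i ≡ g i) → sumFin n f ≡ sumFin n g
  sumFin-cong zero    eq = refl
  sumFin-cong (suc n) eq = cong₂ _+_ (eq zero) (sumFin-cong n (λ i → eq (suc i)))

  sumFin-mono : ∀ n {f g : Fin n → ℕ} → (∀ i → f i ≤ g i) → sumFin n f ≤ sumFin n g
  sumFin-mono zero    le = z≤n
  sumFin-mono (suc n) le = +-mono-≤ (le zero) (sumFin-mono n (λ i → le (suc i)))

  sumFin-*ˡ : ∀ n c (f : Fin n → ℕ) → sumFin n (λ i → c * f i) ≡ c * sumFin n f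
  sumFin-*ˡ zero    c f = sym (*-zeroʳ c)
  sumFin-*ˡ (suc n) c f = trans (cong (c * f zero +_) (sumFin-*ˡ n c _)) (sym (*-distribˡ-+ c (f zero) _))

  sumFin-*ʳ : ∀ n c (f : Fin n → ℕ) → sumFin n (λ i → f i * c) ≡ sumFin n f * c
  sumFin-*ʳ zero    c f = refl
  sumFin-*ʳ (suc n) c f = trans (cong (f zero * c +_) (sumFin-*ʳ n c _)) (sym (*-distribʳ-+ c (f zero) _))

  sumFin-const : ∀ n c → sumFin n (λ _ → c) ≡ n * c
  sumFin-const zero    c = refl
  sumFin-const (suc n) c = cong (c +_) (sumFin-const n c)

  count+count-not : ∀ n (B : Fin n → Bool) → count n B + count n (λ i → not (B i)) ≡ n
  count+count-not zero    B = refl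
  count+count-not (suc n) B with B zero
  ... | true  = cong suc (count+count-not n (λ i → B (suc i)))
  ... | false = trans (+-suc _ _) (cong suc (count+count-not n (λ i → B (suc i))))

  count≤ : ∀ n (B : Fin n → Bool) → count n B ≤ n
  count≤ n B = subst (count n B ≤_) (count+count-not n B) (m≤m+n _ _)

  count-punchIn : ∀ n (B : Fin (suc n) → Bool) x {b} → B x ≡ b →
                  count (suc n) B ≡ indicator b + count n (λ j → B (punchIn x j))
  count-punchIn n       B zero    refl = refl
  count-punchIn (suc n) B (suc x) refl =
    trans (cong (indicator (B zero) +_) (count-punchIn n (λ j → B (suc j)) x refl))
          (x∙yz≈y∙xz (indicator (B zero)) (indicator (B (suc x))) _)

  sumFin-if : ∀ n (B : Fin n → Bool) V W →
              sumFin n (λ i → if B i then V else W) ≡ count n B * V + count n (λ i → not (B i)) * W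
  sumFin-if zero    B V W = refl
  sumFin-if (suc n) B V W with B zero | sumFin-if n (λ i → B (suc i)) V W
  ... | true  | ih = trans (cong (V +_) ih) (sym (+-assoc V _ _))
  ... | false | ih = trans (cong (W +_) ih) (x∙yz≈y∙xz W (count n (λ i → B (suc i)) * V) _)

  count-not : ∀ n (B : Fin n → Bool) {b} m → count n B ≡ b → n ≡ m + b → count n (λ i → not (B i)) ≡ m
  count-not n B {b} m cB n≡ =
    +-cancelˡ-≡ b _ _ (trans (subst (λ z → z + _ ≡ n) cB (count+count-not n B)) (trans n≡ (+-comm m b)))

module Injections where

  open import Data.Nat using (ℕ; zero; suc; _*_)
  open import Data.Fin using (Fin; zero; suc; punchOut)
  open import Data.Fin.Properties using (_≟_; suc-injective; punchOut-injective)
  open import Data.Vec as Vec using (Vec; _∷_; lookup; uncons; tabulate)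
  open import Data.Vec.Properties using (lookup-map; tabulate∘lookup; tabulate-cong)
  open import Data.Product using (_×_; _,_; proj₁; proj₂)
  open import Data.Unit using (⊤; tt)
  open import Relation.Nullary using (yes; no; contradiction)
  open import Relation.Binary.PropositionalEquality using (_≡_; _≢_; refl; sym; trans; cong; module ≡-Reasoning)

  open Counting

  private variable
    A : Set
    d n r : ℕ

  falling : ℕ → ℕ → ℕ
  falling n       zero    = 1
  falling zero    (suc r) = 0
  falling (suc n) (suc r) = suc n * falling n r

  InjectiveVec : Vec (Fin d) r → Set
  InjectiveVec {r = r} v = (i j : Fin r) → lookup v i ≡ lookup v j → i ≡ j

  InjectiveAvoiding : Fin d → Vec (Fin d) r → Set
  InjectiveAvoiding x t = InjectiveVec t × (∀ j → lookup t j ≢ x)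

  lookup-ext : {xs ys : Vec A n} → (∀ i → lookup xs i ≡ lookup ys i) → xs ≡ ys
  lookup-ext {xs = xs} {ys} eq = begin
    xs                  ≡⟨ tabulate∘lookup xs ⟨
    tabulate (lookup xs) ≡⟨ tabulate-cong eq ⟩
    tabulate (lookup ys) ≡⟨ tabulate∘lookup ys ⟩
    ys                  ∎
    where open ≡-Reasoning

  -- punchOut made total; the junk value at y = x is never used
  collapse : Fin (suc (suc d)) → Fin (suc (suc d)) → Fin (suc d)
  collapse x y with x ≟ y
  ... | yes _   = zero
  ... | no  x≢y = punchOut x≢y

  collapse-injective : (x y z : Fin (suc (suc d))) → y ≢ x → z ≢ x → collapse x y ≡ collapse x z → y ≡ z
  collapse-injective x y z y≢x z≢x eq with x ≟ y | x ≟ z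
  ... | yes x≡y | _       = contradiction (sym x≡y) y≢x
  ... | no  _   | yes x≡z = contradiction (sym x≡z) z≢x
  ... | no  x≢y | no  x≢z = punchOut-injective x≢y x≢z eq

  atMost-injective : ∀ d r → AtMost (InjectiveVec {d} {r}) (falling d r)
  atMost-injectiveAvoiding : ∀ d r (x : Fin (suc d)) → AtMost (InjectiveAvoiding {r = r} x) (falling d r)

  atMost-injective d       zero    = atMost-[]
  atMost-injective zero    (suc r) = atMost-∅ λ { (() ∷ _) }
  atMost-injective (suc d) (suc r) =
    atMost-injectiveOn uncons (λ { {_ ∷ _} {_ ∷ _} _ _ refl → refl }) (λ {v} → split {v})
      (atMost-Σ _≟_ (suc d) (falling d r) (atMost-Fin (suc d)) (atMost-injectiveAvoiding d r))
    where
    split : ∀ {v : Vec (Fin (suc d)) (suc r)} → InjectiveVec v →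
            ⊤ × InjectiveAvoiding (proj₁ (uncons v)) (proj₂ (uncons v))
    split {x ∷ t} inj = tt , (λ i j e → suc-injective (inj (suc i) (suc j) e)) , λ j e → contra (inj (suc j) zero e)
      where
      contra : ∀ {j : Fin r} → suc j ≢ zero
      contra ()

  atMost-injectiveAvoiding d       zero    x    = atMost-[]
  atMost-injectiveAvoiding zero    (suc r) zero = atMost-∅ λ { (zero ∷ _) (_ , avoids) → avoids zero refl }
  atMost-injectiveAvoiding (suc d) r       x    =
    atMost-injectiveOn (Vec.map (collapse x)) inj (λ {t} → collapse-preserves {t}) (atMost-injective (suc d) r)
    where
    T : Set
    T = Vec (Fin (suc (suc d))) r
    inj : ∀ {t u : T} → InjectiveAvoiding x t → InjectiveAvoiding x u → Vec.map (collapse x) t ≡ Vec.map (collapse x) u → t ≡ u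
    inj {t} {u} (_ , t-avoids) (_ , u-avoids) e = lookup-ext λ i →
      collapse-injective x _ _ (t-avoids i) (u-avoids i)
        (trans (sym (lookup-map i _ t)) (trans (cong (λ w → lookup w i) e) (lookup-map i _ u)))
    collapse-preserves : ∀ {t : T} → InjectiveAvoiding x t → InjectiveVec (Vec.map (collapse x) t)
    collapse-preserves {t} (inj-t , avoids) i j e = inj-t i j
      (collapse-injective x _ _ (avoids i) (avoids j) (trans (sym (lookup-map i _ t)) (trans e (lookup-map j _ t))))

module Avoiding where

  open import Data.Bool using (Bool; true; false; not; if_then_else_)
  open import Data.Nat using (ℕ; zero; suc; pred; _+_; _*_; _∸_; _^_; _!; _≤_; z≤n; s≤s)
  open import Data.Nat.Properties
  open import Data.Nat.Tactic.RingSolver using (solve-∀)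
  open import Algebra.Properties.CommutativeSemigroup *-commutativeSemigroup using () renaming (x∙yz≈y∙xz to x*yz≡y*xz)
  open import Data.Fin using (Fin; zero; suc; punchIn)
  open import Data.Fin.Properties using (punchIn-injective; punchInᵢ≢i)
  open import Data.Vec as Vec using (Vec; []; _∷_; lookup; head)
  open import Data.Vec.Properties using (lookup-map)
  open import Data.List using ([]; _∷_; [_])
  open import Data.List.Relation.Unary.All using ([]; _∷_)
  open import Data.List.Relation.Unary.AllPairs using ([]; _∷_)
  open import Data.Product using (_×_; _,_)
  open import Relation.Nullary using (¬_; contradiction)
  open import Relation.Binary.PropositionalEquality using (_≡_; _≢_; refl; sym; trans; cong; cong₂; subst; module ≡-Reasoning)

  open import Defs using (sumFin)
  open Counting
  open Injections
  open Sums

  private variable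
    d r : ℕ

  MapsOutside : (Fin r → Bool) → (Fin d → Bool) → Vec (Fin d) r → Set
  MapsOutside A B v = ∀ j → A j ≡ true → B (lookup v j) ≢ true

  InjectiveOutside : (Fin r → Bool) → (Fin d → Bool) → Vec (Fin d) r → Set
  InjectiveOutside A B v = InjectiveVec v × MapsOutside A B v

  falling-diag : ∀ n → falling n n ≡ n !
  falling-diag zero    = refl
  falling-diag (suc n) = cong (suc n *_) (falling-diag n)

  falling-suc : ∀ n e → falling n (suc e) ≡ n * falling (pred n) e
  falling-suc zero    e = refl
  falling-suc (suc n) e = refl

  factorial-falling : ∀ a t → (a + t) ! ≡ falling (a + t) a * t !
  factorial-falling zero    t = sym (+-identityʳ (t !))
  factorial-falling (suc a) t =
    trans (cong (suc (a + t) *_) (factorial-falling a t)) (sym (*-assoc (suc (a + t)) (falling (a + t) a) (t !)))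

  falling-slide : ∀ a s → suc s * falling (a + suc s) a ≡ (a + suc s) * falling (a + s) a
  falling-slide zero    s = refl
  falling-slide (suc a) s = begin
    suc s * (suc (a + suc s) * falling (a + suc s) a) ≡⟨ x*yz≡y*xz (suc s) (suc (a + suc s)) _ ⟩
    suc (a + suc s) * (suc s * falling (a + suc s) a) ≡⟨ cong (suc (a + suc s) *_) (falling-slide a s) ⟩
    suc (a + suc s) * ((a + suc s) * falling (a + s) a) ≡⟨ cong (λ z → suc (a + suc s) * (z * falling (a + s) a)) (+-suc a s) ⟩
    suc (a + suc s) * (suc (a + s) * falling (a + s) a) ∎
    where open ≡-Reasoning

  falling-ratio : ∀ a s n d → s + n + a ≤ d → s ^ a * falling (a + (s + n)) a ≤ falling (a + s) a * d ^ a
  falling-ratio zero    s n d le = ≤-refl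
  falling-ratio (suc a) s n d le = begin
    s * s ^ a * (suc (a + (s + n)) * falling (a + (s + n)) a) ≡⟨ regroup s (s ^ a) (suc (a + (s + n))) (falling (a + (s + n)) a) ⟩
    s * suc (a + (s + n)) * (s ^ a * falling (a + (s + n)) a)  ≤⟨ *-mono-≤ step ih ⟩
    suc (a + s) * d * (falling (a + s) a * d ^ a)              ≡⟨ regroup (suc (a + s)) d (falling (a + s) a) (d ^ a) ⟩
    suc (a + s) * falling (a + s) a * (d * d ^ a)              ∎
    where
    open ≤-Reasoning
    regroup : ∀ x y z w → x * y * (z * w) ≡ x * z * (y * w)
    regroup = solve-∀
    ih : s ^ a * falling (a + (s + n)) a ≤ falling (a + s) a * d ^ a
    ih = falling-ratio a s n d (≤-trans (+-monoʳ-≤ (s + n) (n≤1+n a)) le)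
    step : s * suc (a + (s + n)) ≤ suc (a + s) * d
    step = *-mono-≤ (m≤n+m s (suc a)) (≤-trans (≤-reflexive (trans (cong suc (+-comm a (s + n))) (sym (+-suc (s + n) a)))) le)

  outside-ratio : ∀ m s n → s ^ m * (m + s + n) ! ≤ falling (m + s) m * (s + n) ! * (m + s + n) ^ m
  outside-ratio m s n = begin
    s ^ m * (m + s + n) !                             ≡⟨ cong (λ z → s ^ m * z !) (+-assoc m s n) ⟩
    s ^ m * (m + (s + n)) !                           ≡⟨ cong (s ^ m *_) (factorial-falling m (s + n)) ⟩
    s ^ m * (falling (m + (s + n)) m * (s + n) !)     ≡⟨ *-assoc (s ^ m) _ _ ⟨
    s ^ m * falling (m + (s + n)) m * (s + n) !       ≤⟨ *-monoˡ-≤ ((s + n) !) (falling-ratio m s n (m + s + n) le) ⟩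
    falling (m + s) m * (m + s + n) ^ m * (s + n) !   ≡⟨ swap (falling (m + s) m) ((m + s + n) ^ m) ((s + n) !) ⟩
    falling (m + s) m * (s + n) ! * (m + s + n) ^ m   ∎
    where
    open ≤-Reasoning
    le : s + n + m ≤ m + s + n
    le = ≤-reflexive (trans (+-comm (s + n) m) (sym (+-assoc m s n)))
    swap : ∀ x y z → x * y * z ≡ x * z * y
    swap = solve-∀

  atLeast-cons : ∀ {A : Fin (suc r) → Bool} {B : Fin (suc d) → Bool} {V} x → (A zero ≡ true → B x ≢ true) →
                 AtLeast (InjectiveOutside (λ j → A (suc j)) (λ j → B (punchIn x j))) V →
                 AtLeast (λ v → InjectiveOutside A B v × head v ≡ x) V
  atLeast-cons {r = r} {d = d} {A = A} {B} x x-allowed =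
    atLeast-injectiveOn cons (λ {t} {u} _ _ e → lookup-ext λ i → punchIn-injective x _ _ (tail-lookup t u i e))
      (λ {t} → extend t)
    where
    cons : Vec (Fin d) r → Vec (Fin (suc d)) (suc r)
    cons t = x ∷ Vec.map (punchIn x) t
    tail-lookup : ∀ t u i → cons t ≡ cons u → punchIn x (lookup t i) ≡ punchIn x (lookup u i)
    tail-lookup t u i e =
      trans (sym (lookup-map i (punchIn x) t)) (trans (cong (λ w → lookup (Vec.tail w) i) e) (lookup-map i (punchIn x) u))
    extend : ∀ t → InjectiveOutside (λ j → A (suc j)) (λ j → B (punchIn x j)) t →
             InjectiveOutside A B (cons t) × head (cons t) ≡ x
    extend t (inj-t , outside-t) = (injective , outside) , refl
      where
      injective : InjectiveVec (cons t)
      injective zero    zero    e = refl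
      injective zero    (suc j) e = contradiction (trans (sym (lookup-map j (punchIn x) t)) (sym e)) (punchInᵢ≢i x (lookup t j))
      injective (suc i) zero    e = contradiction (trans (sym (lookup-map i (punchIn x) t)) e) (punchInᵢ≢i x (lookup t i))
      injective (suc i) (suc j) e = cong suc (inj-t i j (punchIn-injective x _ _
        (trans (sym (lookup-map i (punchIn x) t)) (trans e (lookup-map j (punchIn x) t)))))
      outside : MapsOutside A B (cons t)
      outside zero    Aj Bv = x-allowed Aj Bv
      outside (suc j) Aj Bv = outside-t j Aj (trans (cong B (sym (lookup-map j (punchIn x) t))) Bv)

  -- Images for the a constrained positions come from the a + s values outside B,
  -- those of the e free positions from what is left of s + b values.
  LowerBound : (r d : ℕ) → (Fin r → Bool) → Set
  LowerBound r d A = ∀ (B : Fin d → Bool) a s b e → count r A ≡ a → count d B ≡ b → d ≡ a + s + b → r ≡ a + e →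
                     AtLeast (InjectiveOutside A B) (falling (a + s) a * falling (s + b) e)

  constrainedHead : ∀ {A : Fin (suc r) → Bool} → A zero ≡ true → LowerBound r d (λ j → A (suc j)) →
                    LowerBound (suc r) (suc d) A
  constrainedHead {r} {d} {A} A₀ ih B a s b e cA cB dE rE =
    subst (λ a → AtLeast (InjectiveOutside A B) (falling (a + s) a * falling (s + b) e)) 1+a′≡a
      (atLeast-≤ (≤-reflexive total) (atLeast-byTag head value perHead))
    where
    a′ : ℕ
    a′ = count r (λ j → A (suc j))
    1+a′≡a : suc a′ ≡ a
    1+a′≡a = trans (cong (λ z → indicator z + a′) (sym A₀)) cA
    dE′ : suc d ≡ suc a′ + s + b
    dE′ = trans dE (cong (λ z → z + s + b) (sym 1+a′≡a))
    V : ℕ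
    V = falling (a′ + s) a′ * falling (s + b) e
    value : Fin (suc d) → ℕ
    value x = if B x then 0 else V
    perHead : ∀ x → AtLeast (λ v → InjectiveOutside A B v × head v ≡ x) (value x)
    perHead x with B x in Bx
    ... | true  = atLeast-zero
    ... | false = atLeast-cons x (λ _ Bx≡true → contradiction (trans (sym Bx) Bx≡true) λ ())
                    (ih (λ j → B (punchIn x j)) a′ s b e refl cB′ (suc-injective dE′)
                        (suc-injective (trans rE (cong (_+ e) (sym 1+a′≡a)))))
      where
      cB′ : count d (λ j → B (punchIn x j)) ≡ b
      cB′ = trans (sym (count-punchIn d B x Bx)) cB
    total : falling (suc a′ + s) (suc a′) * falling (s + b) e ≡ sumFin (suc d) value
    total = begin
      suc (a′ + s) * falling (a′ + s) a′ * falling (s + b) e ≡⟨ *-assoc (suc (a′ + s)) (falling (a′ + s) a′) _ ⟩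
      (suc a′ + s) * V                                        ≡⟨ cong (_* V) (count-not (suc d) B (suc a′ + s) cB dE′) ⟨
      outsideB * V                                            ≡⟨ cong (_+ outsideB * V) (*-zeroʳ (count (suc d) B)) ⟨
      count (suc d) B * 0 + outsideB * V                      ≡⟨ sumFin-if (suc d) B 0 V ⟨
      sumFin (suc d) value                                    ∎
      where
      open ≡-Reasoning
      outsideB : ℕ
      outsideB = count (suc d) (λ x → not (B x))

  -- the contribution of heads outside B when the head position is free
  slackCount : ℕ → ℕ → ℕ → ℕ → ℕ
  slackCount a zero    b e = 0
  slackCount a (suc s) b e = falling (a + s) a * falling (s + b) e

  freeHead-count : ∀ a s b e → falling (a + s) a * falling (s + b) (suc e) ≡
                   b * (falling (a + s) a * falling (s + pred b) e) + (a + s) * slackCount a s b e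
  freeHead-count a s b e = begin
    F * falling (s + b) (suc e)       ≡⟨ cong (F *_) (falling-suc (s + b) e) ⟩
    F * ((s + b) * G)                 ≡⟨ split F s b G ⟩
    b * (F * G) + s * (F * G)         ≡⟨ cong₂ _+_ (hits b) (slack s) ⟩
    b * (F * falling (s + pred b) e) + (a + s) * slackCount a s b e ∎
    where
    open ≡-Reasoning
    F : ℕ
    F = falling (a + s) a
    G : ℕ
    G = falling (pred (s + b)) e
    split : ∀ F s b G → F * ((s + b) * G) ≡ b * (F * G) + s * (F * G)
    split = solve-∀
    hits : ∀ b → b * (F * falling (pred (s + b)) e) ≡ b * (F * falling (s + pred b) e)
    hits zero    = refl
    hits (suc b) = cong (λ z → suc b * (F * falling (pred z) e)) (+-suc s b)
    slack : ∀ s → s * (falling (a + s) a * falling (pred (s + b)) e) ≡ (a + s) * slackCount a s b e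
    slack zero    = sym (*-zeroʳ (a + 0))
    slack (suc s) = begin
      suc s * (falling (a + suc s) a * X)   ≡⟨ *-assoc (suc s) (falling (a + suc s) a) X ⟨
      suc s * falling (a + suc s) a * X     ≡⟨ cong (_* X) (falling-slide a s) ⟩
      (a + suc s) * falling (a + s) a * X   ≡⟨ *-assoc (a + suc s) (falling (a + s) a) X ⟩
      (a + suc s) * (falling (a + s) a * X) ∎
      where X = falling (s + b) e

  freeHead : ∀ {A : Fin (suc r) → Bool} → A zero ≡ false → LowerBound r d (λ j → A (suc j)) →
             LowerBound (suc r) (suc d) A
  freeHead {r} {d} {A} A₀ ih B a s b zero cA cB dE rE =
    contradiction (≤-trans (≤-reflexive (trans rE (+-identityʳ a))) (subst (_≤ r) cA′ (count≤ r _))) (n≮n r)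
    where
    cA′ : count r (λ j → A (suc j)) ≡ a
    cA′ = trans (cong (λ z → indicator z + count r (λ j → A (suc j))) (sym A₀)) cA
  freeHead {r} {d} {A} A₀ ih B a s b (suc e) cA cB dE rE =
    atLeast-≤ (≤-reflexive total) (atLeast-byTag head value perHead)
    where
    cA′ : count r (λ j → A (suc j)) ≡ a
    cA′ = trans (cong (λ z → indicator z + count r (λ j → A (suc j))) (sym A₀)) cA
    rE′ : r ≡ a + e
    rE′ = suc-injective (trans rE (+-suc a e))
    head-allowed : ∀ x → A zero ≡ true → B x ≢ true
    head-allowed _ A₀≡true = contradiction (trans (sym A₀) A₀≡true) λ ()
    hitCount : ℕ
    hitCount = falling (a + s) a * falling (s + pred b) e
    value : Fin (suc d) → ℕ
    value x = if B x then hitCount else slackCount a s b e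
    perHead : ∀ x → AtLeast (λ v → InjectiveOutside A B v × head v ≡ x) (value x)
    perHead x with B x in Bx
    ... | true  = atLeast-cons x (head-allowed x) (ih (λ j → B (punchIn x j)) a s (pred b) e cA′ cB′ dE′ rE′)
      where
      b≡ : b ≡ suc (count d (λ j → B (punchIn x j)))
      b≡ = trans (sym cB) (count-punchIn d B x Bx)
      cB′ : count d (λ j → B (punchIn x j)) ≡ pred b
      cB′ = cong pred (sym b≡)
      dE′ : d ≡ a + s + pred b
      dE′ = trans (suc-injective (trans dE (trans (cong (a + s +_) b≡) (+-suc (a + s) _)))) (cong (a + s +_) cB′)
    ... | false = slack s dE
      where
      cB′ : count d (λ j → B (punchIn x j)) ≡ b
      cB′ = trans (sym (count-punchIn d B x Bx)) cB
      slack : ∀ s → suc d ≡ a + s + b → AtLeast (λ v → InjectiveOutside A B v × head v ≡ x) (slackCount a s b e)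
      slack zero    _  = atLeast-zero
      slack (suc s) dE = atLeast-cons x (head-allowed x)
        (ih (λ j → B (punchIn x j)) a s b e cA′ cB′ (suc-injective (trans dE (cong (_+ b) (+-suc a s)))) rE′)
    total : falling (a + s) a * falling (s + b) (suc e) ≡ sumFin (suc d) value
    total = begin
      falling (a + s) a * falling (s + b) (suc e)                 ≡⟨ freeHead-count a s b e ⟩
      b * hitCount + (a + s) * slackCount a s b e                 ≡⟨ cong₂ (λ u w → u * hitCount + w * slackCount a s b e)
                                                                       cB (count-not (suc d) B (a + s) cB dE) ⟨
      count (suc d) B * hitCount + outsideB * slackCount a s b e  ≡⟨ sumFin-if (suc d) B hitCount (slackCount a s b e) ⟨
      sumFin (suc d) value                                        ∎
      where
      open ≡-Reasoning
      outsideB : ℕ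
      outsideB = count (suc d) (λ x → not (B x))

  atLeast-injectiveOutside : ∀ r d (A : Fin r → Bool) → LowerBound r d A
  atLeast-injectiveOutside zero    d       A B .zero s b .zero refl _ _ refl =
    [ [] ] , [] ∷ [] , ((λ ()) , (λ ())) ∷ [] , s≤s z≤n
  atLeast-injectiveOutside (suc r) zero    A B zero    zero    zero    .(suc r) _ _ refl refl = atLeast-zero
  atLeast-injectiveOutside (suc r) zero    A B (suc a) s       b       e        _ _ ()   _
  atLeast-injectiveOutside (suc r) zero    A B zero    (suc s) b       e        _ _ ()   _
  atLeast-injectiveOutside (suc r) zero    A B zero    zero    (suc b) e        _ _ ()   _
  atLeast-injectiveOutside (suc r) (suc d) A = byHead (A zero) refl
    where
    byHead : ∀ h → A zero ≡ h → LowerBound (suc r) (suc d) A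
    byHead true  A₀ = constrainedHead A₀ (atLeast-injectiveOutside r d (λ j → A (suc j)))
    byHead false A₀ = freeHead A₀ (atLeast-injectiveOutside r d (λ j → A (suc j)))

  atMost-permutations : ∀ d → AtMost (InjectiveVec {d} {d}) (d !)
  atMost-permutations d = subst (AtMost _) (falling-diag d) (atMost-injective d d)

  atLeast-permutationsOutside : ∀ {d} (A B : Fin d → Bool) s → d ≡ count d A + s + count d B →
                                AtLeast (InjectiveOutside A B) (falling (count d A + s) (count d A) * (s + count d B) !)
  atLeast-permutationsOutside {d} A B s dE =
    subst (λ z → AtLeast _ (falling (count d A + s) (count d A) * z)) (falling-diag (s + count d B))
      (atLeast-injectiveOutside d d A B (count d A) s (count d B) (s + count d B) refl refl dE
        (trans dE (+-assoc (count d A) s (count d B))))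

  atMost-permutationsHitting : ∀ {d} (A B : Fin d → Bool) s → d ≡ count d A + s + count d B →
                               AtMost (λ v → InjectiveVec v × ¬ MapsOutside A B v)
                                      (d ! ∸ falling (count d A + s) (count d A) * (s + count d B) !)
  atMost-permutationsHitting {d} A B s dE = atMost-∸ (atMost-permutations d) (atLeast-permutationsOutside A B s dE)

module Chains where

  open import Data.Bool using (true; false)
  open import Data.Nat using (ℕ; zero; suc; _≤_; _<_; _≡ᵇ_)
  open import Data.Nat.Properties using (≤-refl; ≤-trans; n≤1+n)
  open import Data.Fin using (Fin; toℕ; fromℕ<) renaming (_<_ to _<ᶠ_)
  open import Data.Fin.Properties using (toℕ-fromℕ<)
  open import Data.Fin.Subset using (Subset; _∈_)
  open import Data.Vec using (lookup)
  open import Data.Vec.Properties using ([]=⇒lookup)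
  open import Data.Product using (_,_)
  open import Data.Sum using (inj₁)
  open import Relation.Nullary using (¬_; contradiction)
  open import Relation.Binary.PropositionalEquality using (_≡_; refl; sym; trans; subst)
  open import Relation.Binary.Construct.Closure.ReflexiveTransitive using (Star; ε; _◅_; _◅◅_)

  open import Defs
  open Avoiding using (MapsOutside)

  ∉-lookup : ∀ {d} (S : Subset d) j → lookup S j ≡ false → ¬ (j ∈ S)
  ∉-lookup S j S[j]≡false j∈S with trans (sym S[j]≡false) ([]=⇒lookup j∈S)
  ... | ()

  ≡ᵇ-refl : ∀ n → (n ≡ᵇ n) ≡ true
  ≡ᵇ-refl zero    = refl
  ≡ᵇ-refl (suc n) = ≡ᵇ-refl n

  xv-last : ∀ {k d h} (μ ν : Fin k) (i : Fin h) → 0 < d → xv {k} {d} {h} μ ν i d ≡ t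
  xv-last {d = suc d} μ ν i _ rewrite ≡ᵇ-refl d = refl

  chain-connects : ∀ {k d h} (J : Fin k → Subset d) (ω : Outcome k d h) (μ ν : Fin k) (i : Fin h) →
                   μ <ᶠ ν → Light J μ → Light J ν → 0 < d →
                   MapsOutside (lookup (J μ)) (lookup (J ν)) (lookup (lookup (lookup ω μ) ν) i) →
                   Star (SAdj J ω) s t
  chain-connects {k} {d} {h} J ω μ ν i μ<ν light-μ light-ν d>0 outside =
    subst (Star (SAdj J ω) s) (xv-last μ ν i d>0) (prefix d ≤-refl)
    where
    x : ℕ → Vtx k d h
    x = xv μ ν i
    cycle : (j : Fin d) → Star (SAdj J ω) (x (toℕ j)) (x (suc (toℕ j)))
    cycle j with lookup (J μ) j in μj
    ... | false = inj₁ (μ , ν , (μ , j) , light-μ , light-ν , top-l i j μ<ν , ∉-lookup (J μ) j μj)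
                ◅ inj₁ (μ , ν , (μ , j) , light-μ , light-ν , top-r i j μ<ν , ∉-lookup (J μ) j μj) ◅ ε
    ... | true with lookup (J ν) (perm ω μ ν i j) in νσj
    ...   | true  = contradiction νσj (outside j μj)
    ...   | false = inj₁ (μ , ν , (ν , perm ω μ ν i j) , light-μ , light-ν , bot-l i j μ<ν , ∉-lookup (J ν) _ νσj)
                  ◅ inj₁ (μ , ν , (ν , perm ω μ ν i j) , light-μ , light-ν , bot-r i j μ<ν , ∉-lookup (J ν) _ νσj) ◅ ε
    prefix : ∀ n → n ≤ d → Star (SAdj J ω) s (x n)
    prefix zero    _ = ε
    prefix (suc n) n<d = prefix n (≤-trans (n≤1+n n) n<d) ◅◅
      subst (λ m → Star (SAdj J ω) (x m) (x (suc m))) (toℕ-fromℕ< n<d) (cycle (fromℕ< n<d))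

module LightPairs where

  open import Data.Bool using (Bool; true; false; not; _∧_)
  open import Data.Nat using (ℕ; zero; suc; _+_; _*_; _∸_; _≤_; _≤ᵇ_; _<ᵇ_; z≤n)
  open import Data.Nat.Properties
  open import Data.Nat.Tactic.RingSolver using (solve-∀)
  open import Data.Fin using (Fin; zero; suc; toℕ)
  open import Relation.Nullary.Reflects using (ofⁿ)
  open import Relation.Binary.PropositionalEquality using (_≡_; refl; sym; trans; cong; module ≡-Reasoning)

  open import Defs using (sumFin)
  open Sums

  light? : ∀ k → (Fin k → ℕ) → Fin k → Bool
  light? k f μ = k * f μ ≤ᵇ 4 * sumFin k f

  lightPair? : ∀ {k} → (Fin k → Bool) → Fin k → Fin k → Bool
  lightPair? ℓ μ ν = (toℕ μ <ᵇ toℕ ν) ∧ ℓ μ ∧ ℓ ν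

  lightPairs : ∀ k → (Fin k → Bool) → ℕ
  lightPairs k ℓ = sumFin k (λ μ → sumFin k (λ ν → indicator (lightPair? ℓ μ ν)))

  light-majority : ∀ k (f : Fin k → ℕ) → 3 * k ≤ 4 * count k (light? k f)
  light-majority k f = +-cancelʳ-≤ (4 * H) (3 * k) (4 * L) (begin
    3 * k + 4 * H  ≤⟨ +-monoʳ-≤ (3 * k) 4H≤k ⟩
    3 * k + k      ≡⟨ +-comm (3 * k) k ⟩
    4 * k          ≡⟨ cong (4 *_) (count+count-not k (light? k f)) ⟨
    4 * (L + H)    ≡⟨ *-distribˡ-+ 4 L H ⟩
    4 * L + 4 * H  ∎)
    where
    open ≤-Reasoning
    c : ℕ
    c = sumFin k f
    L : ℕ
    L = count k (light? k f)
    H : ℕ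
    H = count k (λ μ → not (light? k f μ))
    heavy : ∀ μ → indicator (not (light? k f μ)) * suc (4 * c) ≤ k * f μ
    heavy μ with k * f μ ≤ᵇ 4 * c | ≤ᵇ-reflects-≤ (k * f μ) (4 * c)
    ... | true  | _       = z≤n
    ... | false | ofⁿ k≰c = ≤-trans (≤-reflexive (+-identityʳ _)) (≰⇒> k≰c)
    H*[1+4c]≤k*c : H * suc (4 * c) ≤ k * c
    H*[1+4c]≤k*c = begin
      H * suc (4 * c)                                            ≡⟨ sumFin-*ʳ k (suc (4 * c)) _ ⟨
      sumFin k (λ μ → indicator (not (light? k f μ)) * suc (4 * c)) ≤⟨ sumFin-mono k heavy ⟩
      sumFin k (λ μ → k * f μ)                                    ≡⟨ sumFin-*ˡ k k f ⟩
      k * c                                                       ∎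
    4H≤k : 4 * H ≤ k
    4H≤k = *-cancelʳ-≤ (4 * H) k (suc (4 * c)) (begin
      4 * H * suc (4 * c)   ≡⟨ *-assoc 4 H _ ⟩
      4 * (H * suc (4 * c)) ≤⟨ *-monoʳ-≤ 4 H*[1+4c]≤k*c ⟩
      4 * (k * c)           ≤⟨ m≤n+m (4 * (k * c)) k ⟩
      k + 4 * (k * c)       ≡⟨ rearrange k c ⟩
      k * suc (4 * c)       ∎)
      where
      rearrange : ∀ k c → k + 4 * (k * c) ≡ k * suc (4 * c)
      rearrange = solve-∀

  lightPairs-suc : ∀ k (ℓ : Fin (suc k) → Bool) →
                   lightPairs (suc k) ℓ ≡ indicator (ℓ zero) * count k (λ i → ℓ (suc i)) + lightPairs k (λ i → ℓ (suc i))
  lightPairs-suc k ℓ = cong (_+ lightPairs k (λ i → ℓ (suc i))) (firstRow (ℓ zero))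
    where
    firstRow : ∀ b → sumFin k (λ ν → indicator (b ∧ ℓ (suc ν))) ≡ indicator b * count k (λ i → ℓ (suc i))
    firstRow false = trans (sumFin-const k 0) (*-zeroʳ k)
    firstRow true  = sym (+-identityʳ _)

  2*lightPairs+count : ∀ k (ℓ : Fin k → Bool) → 2 * lightPairs k ℓ + count k ℓ ≡ count k ℓ * count k ℓ
  2*lightPairs+count zero    ℓ = refl
  2*lightPairs+count (suc k) ℓ = begin
    2 * lightPairs (suc k) ℓ + (a + L) ≡⟨ cong (λ z → 2 * z + (a + L)) (lightPairs-suc k ℓ) ⟩
    2 * (a * L + N) + (a + L)          ≡⟨ regroup a L N ⟩
    2 * a * L + a + (2 * N + L)        ≡⟨ cong (λ z → 2 * a * L + a + z) (2*lightPairs+count k ℓ′) ⟩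
    2 * a * L + a + L * L              ≡⟨ cong (λ z → 2 * a * L + z + L * L) (indicator-idem (ℓ zero)) ⟨
    2 * a * L + a * a + L * L          ≡⟨ square a L ⟩
    (a + L) * (a + L)                  ∎
    where
    open ≡-Reasoning
    ℓ′ = λ i → ℓ (suc i)
    a : ℕ
    a = indicator (ℓ zero)
    L : ℕ
    L = count k ℓ′
    N : ℕ
    N = lightPairs k ℓ′
    indicator-idem : ∀ b → indicator b * indicator b ≡ indicator b
    indicator-idem true  = refl
    indicator-idem false = refl
    regroup : ∀ a L N → 2 * (a * L + N) + (a + L) ≡ 2 * a * L + a + (2 * N + L)
    regroup = solve-∀
    square : ∀ a L → 2 * a * L + a * a + L * L ≡ (a + L) * (a + L)
    square = solve-∀

  -- i.e. ½ (3k/4) (3k/4 - 1) ≤ lightPairs k ℓ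
  lightPairs-bound : ∀ k (ℓ : Fin k → Bool) → 3 * k ≤ 4 * count k ℓ → 4 ≤ 3 * k →
                     3 * k * (3 * k ∸ 4) ≤ 32 * lightPairs k ℓ
  lightPairs-bound k ℓ 3k≤4L 4≤3k =
    ≤-trans (*-mono-≤ 3k≤4L (∸-monoˡ-≤ 4 3k≤4L)) (≤-reflexive (+-cancelʳ-≡ (16 * L) _ _ (begin
      4 * L * (4 * L ∸ 4) + 16 * L    ≡⟨ cong (4 * L * (4 * L ∸ 4) +_) (trans (*-assoc 4 4 L) (*-comm 4 (4 * L))) ⟩
      4 * L * (4 * L ∸ 4) + 4 * L * 4 ≡⟨ *-distribˡ-+ (4 * L) (4 * L ∸ 4) 4 ⟨
      4 * L * (4 * L ∸ 4 + 4)         ≡⟨ cong (4 * L *_) (m∸n+n≡m (≤-trans 4≤3k 3k≤4L)) ⟩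
      4 * L * (4 * L)                 ≡⟨ sixteen L ⟩
      16 * (L * L)                    ≡⟨ cong (16 *_) (2*lightPairs+count k ℓ) ⟨
      16 * (2 * lightPairs k ℓ + L)   ≡⟨ distrib (lightPairs k ℓ) L ⟩
      32 * lightPairs k ℓ + 16 * L    ∎)))
    where
    open ≡-Reasoning
    L : ℕ
    L = count k ℓ
    sixteen : ∀ L → 4 * L * (4 * L) ≡ 16 * (L * L)
    sixteen = solve-∀
    distrib : ∀ n L → 16 * (2 * n + L) ≡ 32 * n + 16 * L
    distrib = solve-∀

module RationalBounds where

  open import Data.Bool using (true; false)
  open import Data.Bool.Properties using (T-≡)
  open import Data.Nat as ℕ using (ℕ; zero; suc; NonZero)
  import Data.Nat.Properties as ℕ
  open import Data.Nat.Tactic.RingSolver using (solve-∀)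
  open import Data.Integer as ℤ using (+_)
  import Data.Integer.Properties as ℤ
  open import Data.Fin using (Fin; zero; suc)
  open import Data.Product using (_,_)
  open import Data.Sum using (inj₁; inj₂)
  open import Data.Rational using (ℚ; 0ℚ; 1ℚ; _+_; _*_; _-_; -_; _≤_; _<_; toℚᵘ; nonNegative; positive)
  open import Data.Rational.Properties
  open import Data.Rational.Unnormalised as ℚᵘ using (mkℚᵘ)
  import Data.Rational.Unnormalised.Properties as ℚᵘ
  open import Data.Rational.Solver using (module +-*-Solver)
  open +-*-Solver using (solve; _:+_; _:-_; _:=_)
  open import Function.Bundles using (Equivalence)
  open import Relation.Nullary using (yes; no; contradiction)
  open import Relation.Binary.PropositionalEquality using (_≡_; refl; sym; trans; cong; cong₂; subst₂)

  open import Defs using (_^ℚ_; frac; Zq; sumFin; BelowBound)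
  open Counting using (prodFin)

  private variable
    p q r s : ℚ

  toℚᵘ-frac : ∀ a b → toℚᵘ (frac a (suc b)) ℚᵘ.≃ mkℚᵘ (+ a) b
  toℚᵘ-frac a b = toℚᵘ-fromℚᵘ (mkℚᵘ (+ a) b)

  frac≤frac : ∀ a b c e .{{_ : NonZero b}} .{{_ : NonZero e}} → a ℕ.* e ℕ.≤ c ℕ.* b → frac a b ≤ frac c e
  frac≤frac a (suc b) c (suc e) le = toℚᵘ-cancel-≤
    (ℚᵘ.≤-respʳ-≃ (ℚᵘ.≃-sym (toℚᵘ-frac c e)) (ℚᵘ.≤-respˡ-≃ (ℚᵘ.≃-sym (toℚᵘ-frac a b))
      (ℚᵘ.*≤* (subst₂ ℤ._≤_ (ℤ.pos-* a (suc e)) (ℤ.pos-* c (suc b)) (ℤ.+≤+ le)))))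

  frac-* : ∀ a b c e .{{_ : NonZero b}} .{{_ : NonZero e}} → frac a b * frac c e ≡ frac (a ℕ.* c) (b ℕ.* e)
  frac-* a (suc b) c (suc e) = toℚᵘ-injective
    (ℚᵘ.≃-trans (toℚᵘ-homo-* (frac a (suc b)) (frac c (suc e)))
      (ℚᵘ.≃-trans (ℚᵘ.*-cong (toℚᵘ-frac a b) (toℚᵘ-frac c e))
        (ℚᵘ.≃-trans (ℚᵘ.≃-reflexive (cong (λ z → mkℚᵘ z (ℕ.pred (suc b ℕ.* suc e))) (sym (ℤ.pos-* a c))))
          (ℚᵘ.≃-sym (toℚᵘ-frac (a ℕ.* c) (ℕ.pred (suc b ℕ.* suc e)))))))

  frac-+ : ∀ a b c e .{{_ : NonZero b}} .{{_ : NonZero e}} →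
           frac a b + frac c e ≡ frac (a ℕ.* e ℕ.+ c ℕ.* b) (b ℕ.* e)
  frac-+ a (suc b) c (suc e) = toℚᵘ-injective
    (ℚᵘ.≃-trans (toℚᵘ-homo-+ (frac a (suc b)) (frac c (suc e)))
      (ℚᵘ.≃-trans (ℚᵘ.+-cong (toℚᵘ-frac a b) (toℚᵘ-frac c e))
        (ℚᵘ.≃-trans (ℚᵘ.≃-reflexive (cong (λ z → mkℚᵘ z (ℕ.pred (suc b ℕ.* suc e)))
            (sym (trans (ℤ.pos-+ (a ℕ.* suc e) (c ℕ.* suc b)) (cong₂ ℤ._+_ (ℤ.pos-* a (suc e)) (ℤ.pos-* c (suc b)))))))
          (ℚᵘ.≃-sym (toℚᵘ-frac (a ℕ.* suc e ℕ.+ c ℕ.* suc b) (ℕ.pred (suc b ℕ.* suc e)))))))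

  0≤frac : ∀ a b → 0ℚ ≤ frac a b
  0≤frac a zero    = ≤-refl
  0≤frac a (suc b) = frac≤frac 0 1 a (suc b) ℕ.z≤n

  frac-^ : ∀ a b n .{{_ : NonZero b}} → frac a b ^ℚ n ≡ frac (a ℕ.^ n) (b ℕ.^ n)
  frac-^ a b zero    = refl
  frac-^ a b (suc n) {{b≢0}} = trans (cong (frac a b *_) (frac-^ a b n)) (frac-* a b (a ℕ.^ n) (b ℕ.^ n) {{b≢0}} {{ℕ.m^n≢0 b n}})

  0≤* : 0ℚ ≤ p → 0ℚ ≤ q → 0ℚ ≤ p * q
  0≤* {p} {q} 0≤p 0≤q = nonNegative⁻¹ _ {{nonNeg*nonNeg⇒nonNeg p {{nonNegative 0≤p}} q {{nonNegative 0≤q}}}}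

  *-mono-≤-nonNeg : 0ℚ ≤ p → 0ℚ ≤ r → p ≤ q → r ≤ s → p * r ≤ q * s
  *-mono-≤-nonNeg {p} {r} {q} {s} 0≤p 0≤r p≤q r≤s =
    ≤-trans (*-monoʳ-≤-nonNeg r {{nonNegative 0≤r}} p≤q) (*-monoˡ-≤-nonNeg q {{nonNegative (≤-trans 0≤p p≤q)}} r≤s)

  0≤1 : 0ℚ ≤ 1ℚ
  0≤1 = <⇒≤ (positive⁻¹ 1ℚ)

  ≤+⇒-≤ : p ≤ q + r → p - r ≤ q
  ≤+⇒-≤ {p} {q} {r} le = ≤-trans (+-monoˡ-≤ (- r) le) (≤-reflexive (cancel q r))
    where
    cancel : ∀ q r → (q + r) - r ≡ q
    cancel = solve 2 (λ q r → (q :+ r) :- r := q) refl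

  +≤⇒≤- : p + r ≤ q → p ≤ q - r
  +≤⇒≤- {p} {r} {q} le = ≤-trans (≤-reflexive (sym (cancel p r))) (+-monoˡ-≤ (- r) le)
    where
    cancel : ∀ p r → (p + r) - r ≡ p
    cancel = solve 2 (λ p r → (p :+ r) :- r := p) refl

  -≤⇒-≤ : p - q ≤ r → p - r ≤ q
  -≤⇒-≤ {p} {q} {r} le = ≤+⇒-≤ (≤-trans (≤-reflexive (sym (cancel p q))) (+-monoʳ-≤ q le))
    where
    cancel : ∀ p q → q + (p - q) ≡ p
    cancel = solve 2 (λ p q → q :+ (p :- q) := p) refl

  0≤-⇒≤ : 0ℚ ≤ p - q → q ≤ p
  0≤-⇒≤ {p} {q} le = ≤-trans (≤-reflexive (sym (+-identityˡ q))) (≤-trans (+-monoˡ-≤ q le) (≤-reflexive (cancel p q)))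
    where
    cancel : ∀ p q → (p - q) + q ≡ p
    cancel = solve 2 (λ p q → (p :- q) :+ q := p) refl

  ^ℚ-nonNeg : ∀ n → 0ℚ ≤ p → 0ℚ ≤ p ^ℚ n
  ^ℚ-nonNeg zero    0≤p = 0≤1
  ^ℚ-nonNeg (suc n) 0≤p = 0≤* 0≤p (^ℚ-nonNeg n 0≤p)

  ^ℚ-pos : ∀ n → 0ℚ < p → 0ℚ < p ^ℚ n
  ^ℚ-pos zero    0<p = positive⁻¹ 1ℚ
  ^ℚ-pos {p} (suc n) 0<p = positive⁻¹ _ {{pos*pos⇒pos p {{positive 0<p}} _ {{positive (^ℚ-pos n 0<p)}}}}

  ^ℚ-monoˡ-≤ : ∀ n → 0ℚ ≤ p → p ≤ q → p ^ℚ n ≤ q ^ℚ n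
  ^ℚ-monoˡ-≤ zero    0≤p p≤q = ≤-refl
  ^ℚ-monoˡ-≤ (suc n) 0≤p p≤q = *-mono-≤-nonNeg 0≤p (^ℚ-nonNeg n 0≤p) p≤q (^ℚ-monoˡ-≤ n 0≤p p≤q)

  ^ℚ-monoˡ-< : ∀ n → 0ℚ ≤ p → p < q → p ^ℚ suc n < q ^ℚ suc n
  ^ℚ-monoˡ-< {p} {q} n 0≤p p<q = ≤-<-trans
    (*-monoˡ-≤-nonNeg p {{nonNegative 0≤p}} (^ℚ-monoˡ-≤ n 0≤p (<⇒≤ p<q)))
    (*-monoˡ-<-pos (q ^ℚ n) {{positive (^ℚ-pos n (≤-<-trans 0≤p p<q))}} p<q)

  ^ℚ-cancelˡ-≤ : ∀ n → 0ℚ ≤ q → p ^ℚ suc n ≤ q ^ℚ suc n → p ≤ q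
  ^ℚ-cancelˡ-≤ {q} {p} n 0≤q le with p ≤? q
  ... | yes p≤q = p≤q
  ... | no  p≰q = contradiction (<-≤-trans (^ℚ-monoˡ-< n 0≤q (≰⇒> p≰q)) le) (<-irrefl refl)

  1^ℚ : ∀ n → 1ℚ ^ℚ n ≡ 1ℚ
  1^ℚ zero    = refl
  1^ℚ (suc n) = cong (1ℚ *_) (1^ℚ n)

  ^ℚ≤1 : ∀ n → 0ℚ ≤ p → p ≤ 1ℚ → p ^ℚ n ≤ 1ℚ
  ^ℚ≤1 n 0≤p p≤1 = ≤-trans (^ℚ-monoˡ-≤ n 0≤p p≤1) (≤-reflexive (1^ℚ n))

  1≤^ℚ : ∀ n → 1ℚ ≤ p → 1ℚ ≤ p ^ℚ n
  1≤^ℚ zero    1≤p = ≤-refl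
  1≤^ℚ (suc n) 1≤p = *-mono-≤-nonNeg 0≤1 0≤1 1≤p (1≤^ℚ n 1≤p)

  ^ℚ-+ : ∀ p m n → p ^ℚ (m ℕ.+ n) ≡ p ^ℚ m * p ^ℚ n
  ^ℚ-+ p zero    n = sym (*-identityˡ _)
  ^ℚ-+ p (suc m) n = trans (cong (p *_) (^ℚ-+ p m n)) (sym (*-assoc p _ _))

  ^ℚ-* : ∀ p m n → p ^ℚ (m ℕ.* n) ≡ (p ^ℚ n) ^ℚ m
  ^ℚ-* p zero    n = refl
  ^ℚ-* p (suc m) n = trans (^ℚ-+ p n (m ℕ.* n)) (cong (p ^ℚ n *_) (^ℚ-* p m n))

  ^ℚ-antimonoʳ-≤ : ∀ m n → 0ℚ ≤ p → p ≤ 1ℚ → m ℕ.≤ n → p ^ℚ n ≤ p ^ℚ m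
  ^ℚ-antimonoʳ-≤ {p} m n 0≤p p≤1 m≤n = begin
    p ^ℚ n                 ≡⟨ cong (p ^ℚ_) (ℕ.m+[n∸m]≡n m≤n) ⟨
    p ^ℚ (m ℕ.+ (n ℕ.∸ m)) ≡⟨ ^ℚ-+ p m (n ℕ.∸ m) ⟩
    p ^ℚ m * p ^ℚ (n ℕ.∸ m) ≤⟨ *-monoˡ-≤-nonNeg (p ^ℚ m) {{nonNegative (^ℚ-nonNeg m 0≤p)}} (^ℚ≤1 (n ℕ.∸ m) 0≤p p≤1) ⟩
    p ^ℚ m * 1ℚ            ≡⟨ *-identityʳ _ ⟩
    p ^ℚ m                 ∎
    where open ≤-Reasoning

  Z-nonNeg : ∀ c d k → 8 ℕ.* c ℕ.≤ suc d ℕ.* suc k → 0ℚ ≤ Zq c (suc d) (suc k)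
  Z-nonNeg c d k 8c≤dk = +≤⇒≤- {p = 0ℚ} {r = frac (8 ℕ.* c) (suc d ℕ.* suc k)} {q = 1ℚ}
    (≤-trans (≤-reflexive (+-identityˡ _))
      (frac≤frac (8 ℕ.* c) (suc d ℕ.* suc k) 1 1
        (ℕ.≤-trans (ℕ.≤-reflexive (ℕ.*-identityʳ _)) (ℕ.≤-trans 8c≤dk (ℕ.≤-reflexive (sym (ℕ.+-identityʳ _)))))))

  Z≤1 : ∀ c d k → Zq c (suc d) (suc k) ≤ 1ℚ
  Z≤1 c d k = ≤+⇒-≤ {p = 1ℚ} {q = 1ℚ} {r = frac (8 ℕ.* c) (suc d ℕ.* suc k)}
    (≤-trans (≤-reflexive (sym (+-identityʳ 1ℚ))) (+-monoʳ-≤ 1ℚ (0≤frac (8 ℕ.* c) (suc d ℕ.* suc k))))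

  Z≤frac : ∀ c d k m s n → suc d ≡ m ℕ.+ s ℕ.+ n → (m ℕ.+ n) ℕ.* suc k ℕ.≤ 8 ℕ.* c →
           Zq c (suc d) (suc k) ≤ frac s (suc d)
  Z≤frac c d k m s n d≡ mn≤ = ≤+⇒-≤ {p = 1ℚ} {q = frac s (suc d)} {r = frac (8 ℕ.* c) (suc d ℕ.* suc k)}
    (≤-trans (frac≤frac 1 1 (s ℕ.* (D ℕ.* K) ℕ.+ 8 ℕ.* c ℕ.* D) (D ℕ.* (D ℕ.* K)) cross)
             (≤-reflexive (sym (frac-+ s D (8 ℕ.* c) (D ℕ.* K)))))
    where
    D : ℕ
    D = suc d
    K : ℕ
    K = suc k
    cross : 1 ℕ.* (D ℕ.* (D ℕ.* K)) ℕ.≤ (s ℕ.* (D ℕ.* K) ℕ.+ 8 ℕ.* c ℕ.* D) ℕ.* 1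
    cross = begin
      1 ℕ.* (D ℕ.* (D ℕ.* K))                          ≡⟨ cong (λ z → 1 ℕ.* (D ℕ.* (z ℕ.* K))) d≡ ⟩
      1 ℕ.* (D ℕ.* ((m ℕ.+ s ℕ.+ n) ℕ.* K))            ≡⟨ regroup D m s n K ⟩
      (s ℕ.* (D ℕ.* K) ℕ.+ (m ℕ.+ n) ℕ.* K ℕ.* D) ℕ.* 1 ≤⟨ ℕ.*-monoˡ-≤ 1 (ℕ.+-monoʳ-≤ (s ℕ.* (D ℕ.* K)) (ℕ.*-monoˡ-≤ D mn≤)) ⟩
      (s ℕ.* (D ℕ.* K) ℕ.+ 8 ℕ.* c ℕ.* D) ℕ.* 1        ∎
      where
      open ℕ.≤-Reasoning
      regroup : ∀ D m s n K → 1 ℕ.* (D ℕ.* ((m ℕ.+ s ℕ.+ n) ℕ.* K)) ≡ (s ℕ.* (D ℕ.* K) ℕ.+ (m ℕ.+ n) ℕ.* K ℕ.* D) ℕ.* 1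
      regroup = solve-∀

  frac-∸≤ : ∀ L D .{{_ : NonZero D}} → L ℕ.≤ D → frac (D ℕ.∸ L) D ≤ 1ℚ - frac L D
  frac-∸≤ L D {{D≢0}} L≤D = +≤⇒≤- (≤-trans (≤-reflexive (frac-+ (D ℕ.∸ L) D L D))
    (frac≤frac _ (D ℕ.* D) 1 1 {{ℕ.m*n≢0 D D}} (ℕ.≤-reflexive (begin
      ((D ℕ.∸ L) ℕ.* D ℕ.+ L ℕ.* D) ℕ.* 1 ≡⟨ ℕ.*-identityʳ _ ⟩
      (D ℕ.∸ L) ℕ.* D ℕ.+ L ℕ.* D         ≡⟨ ℕ.*-distribʳ-+ D (D ℕ.∸ L) L ⟨
      (D ℕ.∸ L ℕ.+ L) ℕ.* D               ≡⟨ cong (ℕ._* D) (ℕ.m∸n+n≡m L≤D) ⟩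
      D ℕ.* D                             ≡⟨ ℕ.*-identityˡ _ ⟨
      1 ℕ.* (D ℕ.* D)                     ∎))))
    where open Relation.Binary.PropositionalEquality.≡-Reasoning

  -- (1 - y)^k ≤ Z^{4c} with k m ≤ 4c gives 1 - y ≤ Z^m ≤ (s/d)^m ≤ L/D.
  hitting-fraction≤ : ∀ c d k m s n L D .{{_ : NonZero D}} (y : ℚ) →
    suc d ≡ m ℕ.+ s ℕ.+ n → suc k ℕ.* m ℕ.≤ 4 ℕ.* c → suc k ℕ.* n ℕ.≤ 4 ℕ.* c → 8 ℕ.* c ℕ.≤ suc d ℕ.* suc k →
    s ℕ.^ m ℕ.* D ℕ.≤ L ℕ.* suc d ℕ.^ m → L ℕ.≤ D →
    (1ℚ - y) ^ℚ suc k ≤ Zq c (suc d) (suc k) ^ℚ (4 ℕ.* c) →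
    frac (D ℕ.∸ L) D ≤ y
  hitting-fraction≤ c d k m s n L D y d≡ km≤ kn≤ 8c≤dk ratio L≤D hy =
    ≤-trans (frac-∸≤ L D L≤D) (-≤⇒-≤ {p = 1ℚ} {q = y} {r = frac L D} (^ℚ-cancelˡ-≤ k (0≤frac L D) (≤-trans hy Z^4c≤)))
    where
    Z : ℚ
    Z = Zq c (suc d) (suc k)
    0≤Z : 0ℚ ≤ Z
    0≤Z = Z-nonNeg c d k 8c≤dk
    mn≤ : (m ℕ.+ n) ℕ.* suc k ℕ.≤ 8 ℕ.* c
    mn≤ = ℕ.≤-trans (ℕ.≤-reflexive (distrib m n k)) (ℕ.≤-trans (ℕ.+-mono-≤ km≤ kn≤) (ℕ.≤-reflexive (double c)))
      where
      distrib : ∀ m n k → (m ℕ.+ n) ℕ.* suc k ≡ suc k ℕ.* m ℕ.+ suc k ℕ.* n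
      distrib = solve-∀
      double : ∀ c → 4 ℕ.* c ℕ.+ 4 ℕ.* c ≡ 8 ℕ.* c
      double = solve-∀
    Z^m≤ : Z ^ℚ m ≤ frac L D
    Z^m≤ = ≤-trans (^ℚ-monoˡ-≤ m 0≤Z (Z≤frac c d k m s n d≡ mn≤))
             (≤-trans (≤-reflexive (frac-^ s (suc d) m))
               (frac≤frac (s ℕ.^ m) (suc d ℕ.^ m) L D {{ℕ.m^n≢0 (suc d) m}} ratio))
    Z^4c≤ : Z ^ℚ (4 ℕ.* c) ≤ frac L D ^ℚ suc k
    Z^4c≤ = ≤-trans (^ℚ-antimonoʳ-≤ (suc k ℕ.* m) (4 ℕ.* c) 0≤Z (Z≤1 c d k) km≤)
              (≤-trans (≤-reflexive (^ℚ-* Z (suc k) m)) (^ℚ-monoˡ-≤ (suc k) (^ℚ-nonNeg m 0≤Z) Z^m≤))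

  frac-prodFin≤ : ∀ {y} → 0ℚ ≤ y → ∀ n (N e : Fin n → ℕ) D .{{_ : NonZero D}} →
                  (∀ i → frac (N i) D ≤ y ^ℚ e i) → frac (prodFin n N) (D ℕ.^ n) ≤ y ^ℚ sumFin n e
  frac-prodFin≤ 0≤y zero N e D bounds = ≤-refl
  frac-prodFin≤ {y} 0≤y (suc n) N e D {{D≢0}} bounds = begin
    frac (N zero ℕ.* prodFin n N′) (D ℕ.* D ℕ.^ n)     ≡⟨ frac-* (N zero) D (prodFin n N′) (D ℕ.^ n) {{D≢0}} {{ℕ.m^n≢0 D n}} ⟨
    frac (N zero) D * frac (prodFin n N′) (D ℕ.^ n)   ≤⟨ *-mono-≤-nonNeg (0≤frac (N zero) D) (0≤frac (prodFin n N′) (D ℕ.^ n)) (bounds zero)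
                                                          (frac-prodFin≤ 0≤y n N′ e′ D (λ i → bounds (suc i))) ⟩
    y ^ℚ e zero * y ^ℚ sumFin n e′                    ≡⟨ ^ℚ-+ y (e zero) (sumFin n e′) ⟨
    y ^ℚ (e zero ℕ.+ sumFin n e′)                     ∎
    where
    open ≤-Reasoning
    N′ : Fin n → ℕ
    N′ = λ i → N (suc i)
    e′ : Fin n → ℕ
    e′ = λ i → e (suc i)

  ^ℚ-32≤ : ∀ {p y} E P → 0ℚ ≤ p → 0ℚ ≤ y → y ≤ 1ℚ → P ℕ.≤ 32 ℕ.* E → p ≤ y ^ℚ E → p ^ℚ 32 ≤ y ^ℚ P
  ^ℚ-32≤ {p} {y} E P 0≤p 0≤y y≤1 P≤32E p≤y^E = begin
    p ^ℚ 32          ≤⟨ ^ℚ-monoˡ-≤ 32 0≤p p≤y^E ⟩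
    (y ^ℚ E) ^ℚ 32   ≡⟨ ^ℚ-* y 32 E ⟨
    y ^ℚ (32 ℕ.* E)  ≤⟨ ^ℚ-antimonoʳ-≤ P (32 ℕ.* E) 0≤y y≤1 P≤32E ⟩
    y ^ℚ P           ∎
    where open ≤-Reasoning

  -- p ≤ 1 is the case y = 1; otherwise p ≤ y^E and P ≤ 32 E give p^32 ≤ y^P.
  belowBound : ∀ k d h c E p → 8 ℕ.* c ℕ.≤ suc d ℕ.* suc k → 0ℚ ≤ p →
               (4 ℕ.≤ 3 ℕ.* suc k → 3 ℕ.* h ℕ.* suc k ℕ.* (3 ℕ.* suc k ℕ.∸ 4) ℕ.≤ 32 ℕ.* E) →
               (∀ y → 0ℚ ≤ y → (1ℚ - y) ^ℚ suc k ≤ Zq c (suc d) (suc k) ^ℚ (4 ℕ.* c) → p ≤ y ^ℚ E) →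
               BelowBound (suc k) (suc d) h c p
  belowBound k d h c E p 8c≤dk 0≤p exponents bound = byCase
    where
    Z : ℚ
    Z = Zq c (suc d) (suc k)
    0≤Z^4c : 0ℚ ≤ Z ^ℚ (4 ℕ.* c)
    0≤Z^4c = ^ℚ-nonNeg (4 ℕ.* c) (Z-nonNeg c d k 8c≤dk)
    p≤1 : p ≤ 1ℚ
    p≤1 = ≤-trans (bound 1ℚ 0≤1
                    (≤-trans (≤-reflexive (trans (cong (_^ℚ suc k) (+-inverseʳ 1ℚ)) (*-zeroˡ (0ℚ ^ℚ k)))) 0≤Z^4c))
            (≤-reflexive (1^ℚ E))
    byCase : BelowBound (suc k) (suc d) h c p
    byCase with 4 ℕ.≤ᵇ 3 ℕ.* suc k in 4≤3k?
    ... | true  = λ { y (inj₁ 1-y≤0) → y≥1 y 1-y≤0 ; y (inj₂ hy) → admissible y hy }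
      where
      P : ℕ
      P = 3 ℕ.* h ℕ.* suc k ℕ.* (3 ℕ.* suc k ℕ.∸ 4)
      y≥1 : ∀ y → 1ℚ - y ≤ 0ℚ → p ^ℚ 32 ≤ y ^ℚ P
      y≥1 y 1-y≤0 = ≤-trans (^ℚ≤1 32 0≤p p≤1) (1≤^ℚ P (-≤⇒-≤ {p = 1ℚ} {q = y} {r = 0ℚ} 1-y≤0))
      admissible : ∀ y → (1ℚ - y) ^ℚ suc k ≤ Z ^ℚ (4 ℕ.* c) → p ^ℚ 32 ≤ y ^ℚ P
      admissible y hy with 1ℚ - y ≤? 0ℚ
      ... | yes 1-y≤0 = y≥1 y 1-y≤0
      ... | no  1-y≰0 = ^ℚ-32≤ E P 0≤p 0≤y (0≤-⇒≤ 0≤1-y) (exponents (ℕ.≤ᵇ⇒≤ 4 _ (Equivalence.from T-≡ 4≤3k?)))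
                                   (bound y 0≤y hy)
        where
        0≤1-y : 0ℚ ≤ 1ℚ - y
        0≤1-y = <⇒≤ (≰⇒> 1-y≰0)
        1-y≤1 : 1ℚ - y ≤ 1ℚ
        1-y≤1 = ^ℚ-cancelˡ-≤ k 0≤1
          (≤-trans hy (≤-trans (^ℚ≤1 (4 ℕ.* c) (Z-nonNeg c d k 8c≤dk) (Z≤1 c d k)) (≤-reflexive (sym (1^ℚ (suc k))))))
        0≤y : 0ℚ ≤ y
        0≤y = -≤⇒-≤ {p = 1ℚ} {q = y} {r = 1ℚ} 1-y≤1
    ... | false = λ y 0<y (0≤1-y , _) →
      ≤-trans (*-mono-≤-nonNeg (^ℚ-nonNeg 32 0≤p) (^ℚ-nonNeg X (<⇒≤ 0<y)) (^ℚ≤1 32 0≤p p≤1)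
                               (^ℚ≤1 X (<⇒≤ 0<y) (0≤-⇒≤ 0≤1-y)))
              (≤-reflexive (*-identityˡ 1ℚ))
      where
      X : ℕ
      X = 3 ℕ.* h ℕ.* suc k ℕ.* (4 ℕ.∸ 3 ℕ.* suc k)


open import Data.Bool using (Bool; true; false; T; if_then_else_)
open import Data.Bool.Properties using (T-∧)
open import Data.Nat using (ℕ; suc; NonZero; _+_; _*_; _∸_; _^_; _!; _≤_; _<_; z≤n; s≤s)
open import Data.Nat.Properties
open import Data.Nat.Tactic.RingSolver using (solve-∀)
open import Algebra.Properties.CommutativeSemigroup *-commutativeSemigroup using () renaming (x∙yz≈y∙xz to x*yz≡y*xz)
open import Data.Fin using (Fin; toℕ) renaming (_<_ to _<ᶠ_)
open import Data.Fin.Properties using () renaming (_≟_ to _≟ᶠ_)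
open import Data.Fin.Subset using (Subset; ∣_∣)
open import Data.Vec using (Vec; []; _∷_; lookup)
open import Data.Vec.Properties using (≡-dec)
open import Data.List using (List; length)
open import Data.List.Relation.Unary.All using (All)
open import Data.List.Relation.Unary.Unique.Propositional using (Unique)
open import Data.Product using (_×_; _,_; proj₁; proj₂)
open import Data.Unit using (tt)
open import Function.Bundles using (Equivalence)
open import Relation.Nullary using (¬_)
open import Relation.Binary.PropositionalEquality using (_≡_; refl; sym; trans; cong; cong₂; subst; module ≡-Reasoning)

open import Data.Rational as ℚ using (ℚ; 0ℚ; 1ℚ; _-_) renaming (_≤_ to _≤ℚ_)
import Data.Rational.Properties as ℚ

open import Defs
open Counting
open Sums
open Injections
open Avoiding
open Chains
open LightPairs
open RationalBounds using (hitting-fraction≤; frac≤frac; frac-prodFin≤; 0≤frac; belowBound)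

count-lookup : ∀ {d} (S : Subset d) → count d (lookup S) ≡ ∣ S ∣
count-lookup []          = refl
count-lookup (true ∷ S)  = cong suc (count-lookup S)
count-lookup (false ∷ S) = count-lookup S

module _ (k′ d′ h : ℕ) (J : Fin (suc k′) → Subset (suc d′)) where

  private
    k : ℕ
    k = suc k′
    d : ℕ
    d = suc d′

  c : ℕ
  c = card J
  light : Fin k → Bool
  light = light? k (λ μ → ∣ J μ ∣)
  lightPair : Fin k → Fin k → Bool
  lightPair = lightPair? light

  A : Fin k → Fin d → Bool
  A μ = lookup (J μ)

  m : Fin k → ℕ
  m μ = count d (A μ)

  slack : Fin k → Fin k → ℕ
  slack μ ν = d ∸ (m μ + m ν)

  -- a lower bound for the permutations σ^i_{μν} mapping J_μ outside J_ν
  outside : Fin k → Fin k → ℕ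
  outside μ ν = falling (m μ + slack μ ν) (m μ) * (slack μ ν + m ν) !

  choices : Fin k → Fin k → ℕ
  choices μ ν = if lightPair μ ν then d ! ∸ outside μ ν else d !

  χ : Fin k → Fin k → ℕ
  χ μ ν = indicator (lightPair μ ν)

  lightPair-facts : ∀ μ ν → T (lightPair μ ν) → μ <ᶠ ν × Light J μ × Light J ν
  lightPair-facts μ ν lp with Equivalence.to T-∧ lp
  ... | μ<ν , lights with Equivalence.to T-∧ lights
  ...   | light-μ , light-ν = <ᵇ⇒< (toℕ μ) (toℕ ν) μ<ν , ≤ᵇ⇒≤ _ _ light-μ , ≤ᵇ⇒≤ _ _ light-ν

  light-m : ∀ {μ} → Light J μ → k * m μ ≤ 4 * c
  light-m {μ} = subst (λ z → k * z ≤ 4 * c) (sym (count-lookup (J μ)))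

  slack-split : 8 * c < d * k → ∀ μ ν → T (lightPair μ ν) → d ≡ m μ + slack μ ν + m ν
  slack-split 8c<dk μ ν lp = trans (sym (m+[n∸m]≡n m+m≤d)) (swap (m μ) (m ν) (slack μ ν))
    where
    light-μ : Light J μ
    light-μ = proj₁ (proj₂ (lightPair-facts μ ν lp))
    light-ν : Light J ν
    light-ν = proj₂ (proj₂ (lightPair-facts μ ν lp))
    m+m≤d : m μ + m ν ≤ d
    m+m≤d = <⇒≤ (*-cancelʳ-< k (m μ + m ν) d (≤-<-trans (begin
      (m μ + m ν) * k     ≡⟨ *-distribʳ-+ k (m μ) (m ν) ⟩
      m μ * k + m ν * k   ≡⟨ cong₂ _+_ (*-comm (m μ) k) (*-comm (m ν) k) ⟩
      k * m μ + k * m ν   ≤⟨ +-mono-≤ (light-m light-μ) (light-m light-ν) ⟩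
      4 * c + 4 * c       ≡⟨ eight c ⟩
      8 * c               ∎) 8c<dk))
      where
      open ≤-Reasoning
      eight : ∀ c → 4 * c + 4 * c ≡ 8 * c
      eight = solve-∀
    swap : ∀ a b s → a + b + s ≡ a + s + b
    swap = solve-∀

  Admissible : Fin k → Fin k → Vec (Fin d) d → Set
  Admissible μ ν v = InjectiveVec v × (T (lightPair μ ν) → ¬ MapsOutside (A μ) (A ν) v)

  atMost-admissible : 8 * c < d * k → ∀ μ ν → AtMost (Admissible μ ν) (choices μ ν)
  atMost-admissible 8c<dk μ ν with lightPair μ ν in lp
  ... | true  = atMost-mono (λ (inj , hits) → inj , hits tt)
                  (atMost-permutationsHitting (A μ) (A ν) (slack μ ν) (slack-split 8c<dk μ ν (subst T (sym lp) tt)))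
  ... | false = atMost-mono proj₁ (atMost-permutations d)

  good⇒admissible : ∀ {ω : Outcome k d h} → Valid ω × Good J ω → ∀ μ ν i → Admissible μ ν (lookup (lookup (lookup ω μ) ν) i)
  good⇒admissible {ω} (valid , good) μ ν i = valid μ ν i , λ lp outside →
    let μ<ν , light-μ , light-ν = lightPair-facts μ ν lp
    in  good (chain-connects J ω μ ν i μ<ν light-μ light-ν (s≤s z≤n) outside)

  Π : ℕ
  Π = prodFin k (λ μ → prodFin k (λ ν → prodFin h (λ _ → choices μ ν)))

  atMost-good : 8 * c < d * k → AtMost (λ (ω : Outcome k d h) → Valid ω × Good J ω) Π
  atMost-good 8c<dk = atMost-mono (λ {ω} good → good⇒admissible {ω} good)
    (atMost-Vec (≡-dec (≡-dec (≡-dec _≟ᶠ_))) k _ _ λ μ →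
      atMost-Vec (≡-dec (≡-dec _≟ᶠ_)) k _ _ λ ν →
        atMost-Vec (≡-dec _≟ᶠ_) h _ _ λ _ → atMost-admissible 8c<dk μ ν)

  module _ (8c<dk : 8 * c < d * k) {μ ν} (lp : T (lightPair μ ν)) where

    d-split : d ≡ m μ + slack μ ν + m ν
    d-split = slack-split 8c<dk μ ν lp

    ratio : slack μ ν ^ m μ * d ! ≤ outside μ ν * d ^ m μ
    ratio = subst (λ n → slack μ ν ^ m μ * n ! ≤ outside μ ν * n ^ m μ) (sym d-split)
              (outside-ratio (m μ) (slack μ ν) (m ν))

    outside≤d! : outside μ ν ≤ d !
    outside≤d! = atLeast⇒≤ (atMost-mono proj₁ (atMost-permutations d))
                   (atLeast-permutationsOutside (A μ) (A ν) (slack μ ν) d-split)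

    frac-hitting≤ : ∀ y → (1ℚ - y) ^ℚ k ≤ℚ Zq c d k ^ℚ (4 * c) → frac (d ! ∸ outside μ ν) (d !) ≤ℚ y
    frac-hitting≤ y hy =
      hitting-fraction≤ c d′ k′ (m μ) (slack μ ν) (m ν) (outside μ ν) (d !) {{d !≢0}} y d-split
        (light-m (proj₁ (proj₂ (lightPair-facts μ ν lp)))) (light-m (proj₂ (proj₂ (lightPair-facts μ ν lp))))
        (<⇒≤ 8c<dk) ratio outside≤d! hy

  frac-choices≤ : 8 * c < d * k → ∀ y → (1ℚ - y) ^ℚ k ≤ℚ Zq c d k ^ℚ (4 * c) →
                  ∀ μ ν → frac (choices μ ν) (d !) ≤ℚ y ^ℚ χ μ ν
  frac-choices≤ 8c<dk y hy μ ν = byCase (lightPair μ ν) refl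
    where
    byCase : ∀ b → lightPair μ ν ≡ b → frac (if b then d ! ∸ outside μ ν else d !) (d !) ≤ℚ y ^ℚ indicator b
    byCase true  lp = ℚ.≤-trans (frac-hitting≤ 8c<dk (subst T (sym lp) tt) y hy) (ℚ.≤-reflexive (sym (ℚ.*-identityʳ y)))
    byCase false _  = frac≤frac (d !) (d !) 1 1 {{d !≢0}} (≤-reflexive (*-comm (d !) 1))

  E : ℕ
  E = sumFin k (λ μ → sumFin k (λ ν → sumFin h (λ _ → χ μ ν)))

  module _ (8c<dk : 8 * c < d * k) (y : ℚ) (0≤y : 0ℚ ≤ℚ y) (hy : (1ℚ - y) ^ℚ k ≤ℚ Zq c d k ^ℚ (4 * c)) where

    frac-Π≤ : frac Π ((d !) ^ (k * k * h)) ≤ℚ y ^ℚ E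
    frac-Π≤ = subst (λ D → frac Π D ≤ℚ y ^ℚ E) (powers (d !))
      (frac-prodFin≤ 0≤y k _ (λ μ → sumFin k (λ ν → sumFin h (λ _ → χ μ ν)))
         (((d !) ^ h) ^ k) {{m^n≢0 _ k {{m^n≢0 _ h {{d !≢0}}}}}} λ μ →
        frac-prodFin≤ 0≤y k _ (λ ν → sumFin h (λ _ → χ μ ν)) ((d !) ^ h) {{m^n≢0 _ h {{d !≢0}}}} λ ν →
          frac-prodFin≤ 0≤y h _ (λ _ → χ μ ν) (d !) {{d !≢0}} λ _ → frac-choices≤ 8c<dk y hy μ ν)
      where
      powers : ∀ D → ((D ^ h) ^ k) ^ k ≡ D ^ (k * k * h)
      powers D = trans (cong (_^ k) (^-*-assoc D h k)) (trans (^-*-assoc D (h * k) k) (cong (D ^_) (reorder h k)))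
        where
        reorder : ∀ h k → h * k * k ≡ k * k * h
        reorder = solve-∀

  E≡h*lightPairs : E ≡ h * lightPairs k light
  E≡h*lightPairs = begin
    E                                           ≡⟨ sumFin-cong k (λ μ → sumFin-cong k λ ν → sumFin-const h (χ μ ν)) ⟩
    sumFin k (λ μ → sumFin k (λ ν → h * χ μ ν)) ≡⟨ sumFin-cong k (λ μ → sumFin-*ˡ k h (χ μ)) ⟩
    sumFin k (λ μ → h * sumFin k (χ μ))         ≡⟨ sumFin-*ˡ k h (λ μ → sumFin k (χ μ)) ⟩
    h * lightPairs k light                      ∎
    where open ≡-Reasoning

  exponents : 4 ≤ 3 * k → 3 * h * k * (3 * k ∸ 4) ≤ 32 * E
  exponents 4≤3k = begin
    3 * h * k * (3 * k ∸ 4)       ≡⟨ regroup h k (3 * k ∸ 4) ⟩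
    h * (3 * k * (3 * k ∸ 4))     ≤⟨ *-monoʳ-≤ h (lightPairs-bound k light (light-majority k (λ μ → ∣ J μ ∣)) 4≤3k) ⟩
    h * (32 * lightPairs k light) ≡⟨ x*yz≡y*xz h 32 _ ⟩
    32 * (h * lightPairs k light) ≡⟨ cong (32 *_) E≡h*lightPairs ⟨
    32 * E                        ∎
    where
    open ≤-Reasoning
    regroup : ∀ h k t → 3 * h * k * t ≡ h * (3 * k * t)
    regroup = solve-∀

lemma4 : (k d h : ℕ) → 0 < k → 0 < d → 0 < h →
    (J : Fin k → Subset d) →
    8 * card J < d * k →
    (G : List (Outcome k d h)) → Unique G →
    All (λ ω → Valid ω × Good J ω) G →
    BelowBound k d h (card J) (frac (length G) ((d !) ^ (k * k * h)))
lemma4 (suc k) (suc d) h _ _ _ J 8c<dk G unique good =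
  belowBound k d h (card J) (E k d h J) p (<⇒≤ 8c<dk) (0≤frac (length G) D) (exponents k d h J)
    λ y 0≤y hy → ℚ.≤-trans p≤frac-Π (frac-Π≤ k d h J 8c<dk y 0≤y hy)
  where
  D : ℕ
  D = (suc d !) ^ (suc k * suc k * h)
  p : ℚ
  p = frac (length G) D
  p≤frac-Π : p ≤ℚ frac (Π k d h J) D
  p≤frac-Π = frac≤frac (length G) D (Π k d h J) D {{D≢0}} {{D≢0}}
               (*-monoˡ-≤ D (atMost-good k d h J 8c<dk G unique good))
    where
    D≢0 : NonZero D
    D≢0 = m^n≢0 (suc d !) (suc k * suc k * h) {{suc d !≢0}}
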